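{- Let $G$ be an $r$-regular simple graph on $n$ vertices, where $n$ is even, $r>15$ is odd, and $r \geq n/4$. If $G$ is not connected, then $G$ has a complete (perfect) matching.
   Context: All graphs are finite and simple. A complete (perfect) matching of a graph is a set of pairwise disjoint edges covering every vertex. -}

module Defs where

open import Data.Nat using (ℕ; zero; suc; _+_)
open import Data.Fin using (Fin)
open import Data.Bool using (Bool; true; false)
open import Data.List using (List; []; _∷_)
open import Data.Vec.Functional using (Vector)
open import Data.Product using (Σ; ∃; _×_; _,_)
open import Relation.Binary.PropositionalEquality using (_≡_)
open import Relation.Nullary using (¬_)
import Data.Vec.Functional as VF

record SimpleGraph (n : ℕ) : Set where
  field
    adj       : Fin n → Fin n → Bool
    symmetric : ∀ u v → adj u v ≡ adj v u
    loopless  : ∀ v → adj v v ≡ false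
open SimpleGraph public

Adj : ∀ {n} → SimpleGraph n → Fin n → Fin n → Set
Adj G u v = adj G u v ≡ true

bit : Bool → ℕ
bit true  = 1
bit false = 0

degree : ∀ {n} → SimpleGraph n → Fin n → ℕ
degree {n} G v = VF.foldr (λ b acc → bit b + acc) 0 (λ w → adj G v w)

Regular : ∀ {n} → ℕ → SimpleGraph n → Set
Regular r G = ∀ v → degree G v ≡ r

data Walk {n} (G : SimpleGraph n) : Fin n → Fin n → Set where
  nil  : ∀ {u} → Walk G u u
  cons : ∀ {u w v} → Adj G u w → Walk G w v → Walk G u v

Connected : ∀ {n} → SimpleGraph n → Set
Connected G = ∀ u v → Walk G u v

-- perfect matching: every vertex v is matched to a neighbour m v, with m an involution;
-- the edges {v , m v} are then pairwise disjoint and cover every vertex.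
PerfectMatching : ∀ {n} → SimpleGraph n → Set
PerfectMatching {n} G =
  Σ (Fin n → Fin n) λ m → (∀ v → Adj G v (m v)) × (∀ v → m (m v) ≡ v)

-- By Tutte's theorem it suffices to refute a set S whose removal leaves more than ∣ S ∣ odd components
-- (by parity, at least ∣ S ∣ + 2 of them). As r is odd, every odd component H of G − S sends an odd
-- number of edges to S, and at least r of them when ∣ H ∣ ≤ r, while S receives at most r ∣ S ∣ edges.
-- Hence a union X of components of G contains fewer than ∣ S ∩ X ∣ + M odd components, where M ≥ 1
-- disjoint blocks of r + 1 vertices fit in X. Applied to a component and to its complement this gives
-- four such blocks, contradicting n ≤ 4 r.
-- Tutte's theorem is proved by saturation: in an edge-maximal graph without perfect matching, an
-- alternating-cycle argument shows that the non-universal vertices form disjoint cliques.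

module Submission where

open import Defs
open import Data.Nat using (ℕ; zero; suc; _+_; _*_; _∸_; _≤_; _<_; z≤n; s≤s; _≤?_; _<?_; NonZero)
open import Data.Nat.Properties
open import Data.Nat.Divisibility using (_∣_; divides)
open import Data.Nat.GeneralisedArithmetic using (iterate)
open import Data.Nat.Tactic.RingSolver using (solve-∀)
open import Data.Fin using (Fin; zero; suc; toℕ)
import Data.Fin.Properties as Fin
open import Data.Bool using (Bool; true; false; not; _∧_; _∨_; _xor_)
import Data.Bool.Properties as Bool
open import Data.Product using (Σ; ∃; _×_; _,_; proj₁; proj₂)
open import Data.Sum using (_⊎_; inj₁; inj₂; [_,_])
open import Data.Empty using (⊥; ⊥-elim)
open import Function using (_∘_)
open import Data.Vec.Functional using (_∷_; foldr)
open import Relation.Nullary using (¬_; Dec; yes; no)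
open import Relation.Nullary.Decidable using (⌊_⌋; _×-dec_; _⊎-dec_)
open import Relation.Binary.PropositionalEquality hiding ([_])
open import Algebra.Properties.Semiring.Sum +-*-semiring
  using (sum; ∑-distrib-+; ∑-comm; sum-cong-≗; *-distribˡ-sum)

sum-mono-≤ : ∀ {n} {f g : Fin n → ℕ} → (∀ i → f i ≤ g i) → sum f ≤ sum g
sum-mono-≤ {zero}  f≤g = z≤n
sum-mono-≤ {suc n} f≤g = +-mono-≤ (f≤g zero) (sum-mono-≤ (f≤g ∘ suc))

sum-mono-< : ∀ {n} {f g : Fin n → ℕ} → (∀ i → f i ≤ g i) → ∀ k → f k < g k → sum f < sum g
sum-mono-< f≤g zero    fk<gk = +-mono-<-≤ fk<gk (sum-mono-≤ (f≤g ∘ suc))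
sum-mono-< f≤g (suc k) fk<gk = +-mono-≤-< (f≤g zero) (sum-mono-< (f≤g ∘ suc) k fk<gk)

≤-sum : ∀ {n} (f : Fin n → ℕ) k → f k ≤ sum f
≤-sum f zero    = m≤m+n (f zero) _
≤-sum f (suc k) = ≤-trans (≤-sum (f ∘ suc) k) (m≤n+m _ (f zero))

sum-zero : ∀ {n} {f : Fin n → ℕ} → (∀ i → f i ≡ 0) → sum f ≡ 0
sum-zero {zero}  f≡0 = refl
sum-zero {suc n} f≡0 rewrite f≡0 zero = sum-zero (f≡0 ∘ suc)

sum>0⇒∃ : ∀ {n} (f : Fin n → ℕ) → 0 < sum f → ∃ λ i → 0 < f i
sum>0⇒∃ {suc n} f 0<sum with f zero in eq
... | suc _ = zero , subst (0 <_) (sym eq) (s≤s z≤n)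
... | zero  with sum>0⇒∃ (f ∘ suc) 0<sum
...   | i , 0<fi = suc i , 0<fi

sum-single : ∀ {n} (f : Fin n → ℕ) k → (∀ i → i ≢ k → f i ≡ 0) → sum f ≡ f k
sum-single f zero    f≡0 = trans (cong (f zero +_) (sum-zero λ i → f≡0 (suc i) λ ())) (+-identityʳ _)
sum-single f (suc k) f≡0 rewrite f≡0 zero (λ ()) =
  sum-single (f ∘ suc) k λ i i≢k → f≡0 (suc i) (i≢k ∘ Fin.suc-injective)

sum-≤1 : ∀ {n} (f : Fin n → ℕ) → (∀ i → f i ≤ 1) → (∀ i j → 0 < f i → 0 < f j → i ≡ j) → sum f ≤ 1
sum-≤1 {zero}  f f≤1 unique = z≤n
sum-≤1 {suc n} f f≤1 unique with f zero in eq | f≤1 zero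
... | zero  | _ = sum-≤1 (f ∘ suc) (f≤1 ∘ suc) λ i j p q → Fin.suc-injective (unique (suc i) (suc j) p q)
... | suc zero | _ = ≤-reflexive (cong suc (sum-zero rest≡0))
  where
  rest≡0 : ∀ i → f (suc i) ≡ 0
  rest≡0 i with f (suc i) in eq′
  ... | zero = refl
  ... | suc _ with unique zero (suc i) (subst (0 <_) (sym eq) (s≤s z≤n)) (subst (0 <_) (sym eq′) (s≤s z≤n))
  ...   | ()
... | suc (suc _) | s≤s ()

odd : ℕ → Bool
odd zero    = false
odd (suc n) = not (odd n)

odd-+ : ∀ m n → odd (m + n) ≡ odd m xor odd n
odd-+ zero    n = refl
odd-+ (suc m) n = trans (cong not (odd-+ m n)) (Bool.not-distribˡ-xor (odd m) (odd n))

odd-* : ∀ m n → odd (m * n) ≡ odd m ∧ odd n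
odd-* zero    n = refl
odd-* (suc m) n rewrite odd-+ n (m * n) | odd-* m n with odd m | odd n
... | true  | true  = refl
... | true  | false = refl
... | false | b     = Bool.xor-identityʳ b

odd⇒pos : ∀ n → odd n ≡ true → 1 ≤ n
odd⇒pos (suc n) _ = s≤s z≤n

even-suc⇒pos : ∀ k → odd (suc k) ≡ false → 0 < k
even-suc⇒pos zero    ()
even-suc⇒pos (suc k) _ = s≤s z≤n

odd⇒nonZero : ∀ {n} → odd n ≡ true → NonZero n
odd⇒nonZero {suc n} _ = _

odd-double : ∀ n → odd (n + n) ≡ false
odd-double n = trans (odd-+ n n) (Bool.xor-same (odd n))

2∣⇒¬odd : ∀ {n} → 2 ∣ n → odd n ≡ false
2∣⇒¬odd (divides q refl) = trans (odd-* q 2) (Bool.∧-zeroʳ (odd q))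

¬2∣⇒odd : ∀ n → ¬ 2 ∣ n → odd n ≡ true
¬2∣⇒odd zero          ¬2∣n = ⊥-elim (¬2∣n (divides 0 refl))
¬2∣⇒odd (suc zero)    ¬2∣n = refl
¬2∣⇒odd (suc (suc n)) ¬2∣n =
  trans (Bool.not-involutive (odd n)) (¬2∣⇒odd n λ { (divides q refl) → ¬2∣n (divides (suc q) refl) })

even-sum-<⇒+2≤ : ∀ {x y} → odd (x + y) ≡ false → x < y → x + 2 ≤ y
even-sum-<⇒+2≤ {x} {y} even x<y with m≤n⇒m<n∨m≡n x<y
... | inj₁ 1+x<y = subst (_≤ y) (+-comm 2 x) 1+x<y
... | inj₂ refl with trans (sym (cong odd (+-suc x x))) even
...   | odd-1+2x rewrite odd-double x with odd-1+2x
...     | ()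

Subset : ℕ → Set
Subset n = Fin n → Bool

∣_∣ : ∀ {n} → Subset n → ℕ
∣ X ∣ = sum λ i → bit (X i)

_==_ : ∀ {n} → Fin n → Fin n → Bool
i == j = ⌊ i Fin.≟ j ⌋

⁅_⁆ : ∀ {n} → Fin n → Subset n
⁅ v ⁆ w = w == v

_∩_ _∖_ : ∀ {n} → Subset n → Subset n → Subset n
(X ∩ Y) v = X v ∧ Y v
(X ∖ Y) v = X v ∧ not (Y v)

full : ∀ {n} → Subset n
full _ = true

∁ : ∀ {n} → Subset n → Subset n
∁ X v = not (X v)

_⊆_ : ∀ {n} → Subset n → Subset n → Set
X ⊆ Y = ∀ v → X v ≡ true → Y v ≡ true

∨-true : ∀ a {b} → a ∨ b ≡ true → a ≡ true ⊎ b ≡ true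
∨-true true  _ = inj₁ refl
∨-true false b = inj₂ b

∧-true : ∀ a {b} → a ∧ b ≡ true → a ≡ true × b ≡ true
∧-true true b = refl , b

==-refl : ∀ {n} (i : Fin n) → i == i ≡ true
==-refl i with i Fin.≟ i
... | yes _ = refl
... | no i≢i = ⊥-elim (i≢i refl)

==⇒≡ : ∀ {n} {i j : Fin n} → i == j ≡ true → i ≡ j
==⇒≡ {i = i} {j} i==j with i Fin.≟ j
... | yes i≡j = i≡j

≢⇒==false : ∀ {n} {i j : Fin n} → i ≢ j → i == j ≡ false
≢⇒==false {i = i} {j} i≢j with i Fin.≟ j
... | yes i≡j = ⊥-elim (i≢j i≡j)
... | no _    = refl

bit-mono : ∀ {a b} → (a ≡ true → b ≡ true) → bit a ≤ bit b
bit-mono {false}         _   = z≤n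
bit-mono {true} {true}   _   = s≤s z≤n
bit-mono {true} {false}  a⇒b with a⇒b refl
... | ()

∣∣-cong : ∀ {n} {X Y : Subset n} → (∀ v → X v ≡ Y v) → ∣ X ∣ ≡ ∣ Y ∣
∣∣-cong X≡Y = sum-cong-≗ (cong bit ∘ X≡Y)

∣∣-mono : ∀ {n} {X Y : Subset n} → X ⊆ Y → ∣ X ∣ ≤ ∣ Y ∣
∣∣-mono X⊆Y = sum-mono-≤ λ v → bit-mono (X⊆Y v)

∣∣-mono-< : ∀ {n} {X Y : Subset n} → X ⊆ Y → ∀ v → X v ≡ false → Y v ≡ true → ∣ X ∣ < ∣ Y ∣
∣∣-mono-< {X = X} {Y} X⊆Y v Xv Yv =
  sum-mono-< (λ w → bit-mono (X⊆Y w)) v (subst₂ (λ a b → bit a < bit b) (sym Xv) (sym Yv) (s≤s z≤n))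

∣∣≤n : ∀ {n} (X : Subset n) → ∣ X ∣ ≤ n
∣∣≤n {zero}  X = z≤n
∣∣≤n {suc n} X = +-mono-≤ (bit-mono {b = true} λ _ → refl) (∣∣≤n (X ∘ suc))

∣full∣ : ∀ {n} → ∣ full {n} ∣ ≡ n
∣full∣ {zero}  = refl
∣full∣ {suc n} = cong suc ∣full∣

∣⁅⁆∣ : ∀ {n} (v : Fin n) → ∣ ⁅ v ⁆ ∣ ≡ 1
∣⁅⁆∣ v = trans (sum-single _ v λ w w≢v → cong bit (≢⇒==false w≢v)) (cong bit (==-refl v))

∈⇒∣∣>0 : ∀ {n} (X : Subset n) {v} → X v ≡ true → 0 < ∣ X ∣
∈⇒∣∣>0 X {v} Xv = ≤-trans (≤-reflexive (cong bit (sym Xv))) (≤-sum (λ w → bit (X w)) v)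

∣∣>0⇒∈ : ∀ {n} (X : Subset n) → 0 < ∣ X ∣ → ∃ λ v → X v ≡ true
∣∣>0⇒∈ X 0<∣X∣ with sum>0⇒∃ _ 0<∣X∣
... | v , _ with X v in Xv
...   | true = v , Xv

∣∣-split : ∀ {n} (X Y : Subset n) → ∣ X ∣ ≡ ∣ X ∩ Y ∣ + ∣ X ∖ Y ∣
∣∣-split X Y = trans (sum-cong-≗ split) (∑-distrib-+ (λ w → bit ((X ∩ Y) w)) (λ w → bit ((X ∖ Y) w)))
  where
  split : ∀ w → bit (X w) ≡ bit (X w ∧ Y w) + bit (X w ∧ not (Y w))
  split w with X w | Y w
  ... | true  | true  = refl
  ... | true  | false = refl
  ... | false | _     = refl

∣∣-remove : ∀ {n} (X : Subset n) {v} → X v ≡ true → ∣ X ∣ ≡ suc ∣ X ∖ ⁅ v ⁆ ∣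
∣∣-remove X {v} Xv = begin
  ∣ X ∣                          ≡⟨ ∣∣-split X ⁅ v ⁆ ⟩
  ∣ X ∩ ⁅ v ⁆ ∣ + ∣ X ∖ ⁅ v ⁆ ∣  ≡⟨ cong (_+ ∣ X ∖ ⁅ v ⁆ ∣) (trans (∣∣-cong at-v) (∣⁅⁆∣ v)) ⟩
  suc ∣ X ∖ ⁅ v ⁆ ∣              ∎
  where
  open ≡-Reasoning
  at-v : ∀ w → X w ∧ (w == v) ≡ (w == v)
  at-v w with w Fin.≟ v
  ... | yes refl = cong (_∧ true) Xv
  ... | no _     = Bool.∧-zeroʳ (X w)

involution-even : ∀ {n} (m : Fin n → Fin n) (X : Subset n) →
  (∀ v → X v ≡ true → X (m v) ≡ true) → (∀ v → X v ≡ true → m v ≢ v) →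
  (∀ v → X v ≡ true → m (m v) ≡ v) → odd ∣ X ∣ ≡ false
involution-even {n} m X = go ∣ X ∣ X ≤-refl
  where
  go : ∀ fuel (X : Subset n) → ∣ X ∣ ≤ fuel →
    (∀ v → X v ≡ true → X (m v) ≡ true) → (∀ v → X v ≡ true → m v ≢ v) →
    (∀ v → X v ≡ true → m (m v) ≡ v) → odd ∣ X ∣ ≡ false
  go fuel X ∣X∣≤fuel closed fixfree inv with ∣ X ∣ in ∣X∣≡
  ... | zero = refl
  go zero X () closed fixfree inv | suc _
  go (suc fuel) X ∣X∣≤fuel closed fixfree inv | suc k
    with ∣∣>0⇒∈ X (subst (0 <_) (sym ∣X∣≡) (s≤s z≤n))
  ... | v , Xv =
    subst (λ s → odd (suc s) ≡ false) (sym k≡) (trans (Bool.not-involutive _) (go fuel X₂ ∣X₂∣≤fuel closed₂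
      (λ w X₂w → fixfree w (proj₁ (X₂⇒X w X₂w))) (λ w X₂w → inv w (proj₁ (X₂⇒X w X₂w)))))
    where
    X₂ = (X ∖ ⁅ v ⁆) ∖ ⁅ m v ⁆
    mv≢v = fixfree v Xv
    k≡ : k ≡ suc ∣ X₂ ∣
    k≡ = suc-injective (begin
      suc k                   ≡⟨ ∣X∣≡ ⟨
      ∣ X ∣                   ≡⟨ ∣∣-remove X Xv ⟩
      suc ∣ X ∖ ⁅ v ⁆ ∣       ≡⟨ cong suc (∣∣-remove (X ∖ ⁅ v ⁆) (cong₂ (λ a b → a ∧ not b) (closed v Xv) (≢⇒==false mv≢v))) ⟩
      suc (suc ∣ X₂ ∣)        ∎)
      where open ≡-Reasoning
    X₂⇒X : ∀ w → X₂ w ≡ true → X w ≡ true × w ≢ v × w ≢ m v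
    X₂⇒X w X₂w with X w | w Fin.≟ v | w Fin.≟ m v
    ... | true | no w≢v | no w≢mv = refl , w≢v , w≢mv
    closed₂ : ∀ w → X₂ w ≡ true → X₂ (m w) ≡ true
    closed₂ w X₂w with X₂⇒X w X₂w
    ... | Xw , w≢v , w≢mv rewrite closed w Xw
        | ≢⇒==false {i = m w} {j = v} (λ mw≡v → w≢mv (trans (sym (inv w Xw)) (cong m mw≡v)))
        | ≢⇒==false {i = m w} {j = m v} (λ mw≡mv → w≢v (trans (sym (inv w Xw)) (trans (cong m mw≡mv) (inv v Xv))))
        = refl
    ∣X₂∣≤fuel : ∣ X₂ ∣ ≤ fuel
    ∣X₂∣≤fuel = ≤-trans (n≤1+n _) (subst (_≤ fuel) k≡ (≤-pred ∣X∣≤fuel))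

-- Partial matchings

module _ {n} (G : SimpleGraph n) where

  Adj-irrefl : ∀ {u v} → Adj G u v → u ≢ v
  Adj-irrefl {u} uv refl with trans (sym uv) (loopless G u)
  ... | ()

  Adj-sym : ∀ {u v} → Adj G u v → Adj G v u
  Adj-sym {u} {v} uv = trans (symmetric G v u) uv

  -- The fixed points of the involution m are the unmatched vertices.
  record PartialMatching (m : Fin n → Fin n) : Set where
    field
      involutive : ∀ v → m (m v) ≡ v
      matched    : ∀ v → m v ≡ v ⊎ Adj G v (m v)

  unmatched : (Fin n → Fin n) → Subset n
  unmatched m v = m v == v

  ∉unmatched⇒≢ : ∀ {m v} → unmatched m v ≡ false → m v ≢ v
  ∉unmatched⇒≢ {m} {v} unmatched≡false mv≡v rewrite mv≡v | ==-refl v with unmatched≡false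
  ... | ()

  ≡⇒∈unmatched : ∀ {m v} → m v ≡ v → unmatched m v ≡ true
  ≡⇒∈unmatched {v = v} mv≡v rewrite mv≡v = ==-refl v

  perfect : ∀ {m} → PartialMatching m → (∀ v → m v ≢ v) → PerfectMatching G
  perfect {m} pm fixfree = m , (λ v → adjacent v (matched v)) , involutive
    where
    open PartialMatching pm
    adjacent : ∀ v → m v ≡ v ⊎ Adj G v (m v) → Adj G v (m v)
    adjacent v (inj₁ mv≡v) = ⊥-elim (fixfree v mv≡v)
    adjacent v (inj₂ adj)  = adj

  ∣unmatched∣-even : ∀ {m} → odd n ≡ false → PartialMatching m → odd ∣ unmatched m ∣ ≡ false
  ∣unmatched∣-even {m} n-even pm = begin
    odd ∣ U ∣                        ≡⟨ Bool.xor-identityʳ (odd ∣ U ∣) ⟨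
    odd ∣ U ∣ xor false              ≡⟨ cong (odd ∣ U ∣ xor_) M-even ⟨
    odd ∣ U ∣ xor odd ∣ M ∣          ≡⟨ odd-+ ∣ U ∣ ∣ M ∣ ⟨
    odd (∣ U ∣ + ∣ M ∣)              ≡⟨ cong odd (∣∣-split full U) ⟨
    odd ∣ full {n} ∣                 ≡⟨ cong odd (∣full∣ {n}) ⟩
    odd n                            ≡⟨ n-even ⟩
    false                            ∎
    where
    open ≡-Reasoning
    open PartialMatching pm
    U = unmatched m
    M = full ∖ U
    M-even : odd ∣ M ∣ ≡ false
    M-even = involution-even m M
      (λ v Mv → cong not (≢⇒==false λ mmv≡mv → ∉unmatched⇒≢ {m} (Bool.not-injective Mv)
                                                   (sym (trans (sym (involutive v)) mmv≡mv))))
      (λ v Mv → ∉unmatched⇒≢ {m} (Bool.not-injective Mv))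
      (λ v _ → involutive v)

matchPair : ∀ {n} → (Fin n → Fin n) → Fin n → Fin n → Fin n → Fin n
matchPair m u v w with w Fin.≟ u
... | yes _ = v
... | no _ with w Fin.≟ v
...   | yes _ = u
...   | no _  = m w

module _ {n} (m : Fin n → Fin n) (u v : Fin n) where

  matchPair-u : matchPair m u v u ≡ v
  matchPair-u with u Fin.≟ u
  ... | yes _   = refl
  ... | no u≢u  = ⊥-elim (u≢u refl)

  matchPair-v : u ≢ v → matchPair m u v v ≡ u
  matchPair-v u≢v with v Fin.≟ u
  ... | yes v≡u = ⊥-elim (u≢v (sym v≡u))
  ... | no _ with v Fin.≟ v
  ...   | yes _  = refl
  ...   | no v≢v = ⊥-elim (v≢v refl)

  matchPair-other : ∀ w → w ≢ u → w ≢ v → matchPair m u v w ≡ m w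
  matchPair-other w w≢u w≢v with w Fin.≟ u
  ... | yes w≡u = ⊥-elim (w≢u w≡u)
  ... | no _ with w Fin.≟ v
  ...   | yes w≡v = ⊥-elim (w≢v w≡v)
  ...   | no _    = refl

module _ {n} (G : SimpleGraph n) {m : Fin n → Fin n} (pm : PartialMatching G m)
         {u v : Fin n} (mu≡u : m u ≡ u) (mv≡v : m v ≡ v) (uv : Adj G u v) where

  open PartialMatching pm
  private
    u≢v = Adj-irrefl G uv
    m′ = matchPair m u v

  matchPair-partialMatching : PartialMatching G m′
  matchPair-partialMatching = record { involutive = involutive′ ; matched = matched′ }
    where
    m≢ : ∀ {w x} → m x ≡ x → w ≢ x → m w ≢ x
    m≢ mx≡x w≢x mw≡x = w≢x (trans (sym (involutive _)) (trans (cong m mw≡x) mx≡x))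
    involutive′ : ∀ w → m′ (m′ w) ≡ w
    involutive′ w with w Fin.≟ u
    ... | yes refl rewrite matchPair-u m u v = matchPair-v m u v u≢v
    ... | no w≢u with w Fin.≟ v
    ...   | yes refl = matchPair-u m u v
    ...   | no w≢v = trans (matchPair-other m u v (m w) (m≢ mu≡u w≢u) (m≢ mv≡v w≢v)) (involutive w)
    matched′ : ∀ w → m′ w ≡ w ⊎ Adj G w (m′ w)
    matched′ w with w Fin.≟ u
    ... | yes refl = inj₂ uv
    ... | no _ with w Fin.≟ v
    ...   | yes refl = inj₂ (Adj-sym G uv)
    ...   | no _     = matched w

  unmatched-matchPair : ∀ w → unmatched G m′ w ≡ ((unmatched G m ∖ ⁅ u ⁆) ∖ ⁅ v ⁆) w
  unmatched-matchPair w with w Fin.≟ u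
  ... | yes refl rewrite ==-refl u | ≢⇒==false u≢v =
        trans (≢⇒==false (u≢v ∘ sym)) (sym (cong (_∧ true) (Bool.∧-zeroʳ _)))
  ... | no w≢u with w Fin.≟ v
  ...   | yes refl rewrite ==-refl v = trans (≢⇒==false u≢v) (sym (Bool.∧-zeroʳ _))
  ...   | no w≢v rewrite ≢⇒==false w≢u | ≢⇒==false w≢v =
          sym (trans (Bool.∧-identityʳ _) (Bool.∧-identityʳ _))

  unmatched-matchPair-⊆ : unmatched G m′ ⊆ unmatched G m
  unmatched-matchPair-⊆ w U′w = proj₁ (∧-true _ (proj₁ (∧-true _ (trans (sym (unmatched-matchPair w)) U′w))))

  ∣unmatched∣-matchPair : ∣ unmatched G m ∣ ≡ suc (suc ∣ unmatched G m′ ∣)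
  ∣unmatched∣-matchPair = begin
    ∣ U ∣                        ≡⟨ ∣∣-remove U (≡⇒∈unmatched G {m} mu≡u) ⟩
    suc ∣ U ∖ ⁅ u ⁆ ∣            ≡⟨ cong suc (∣∣-remove (U ∖ ⁅ u ⁆) v∈) ⟩
    suc (suc ∣ (U ∖ ⁅ u ⁆) ∖ ⁅ v ⁆ ∣) ≡⟨ cong (λ k → suc (suc k)) (∣∣-cong unmatched-matchPair) ⟨
    suc (suc ∣ unmatched G m′ ∣) ∎
    where
    open ≡-Reasoning
    U = unmatched G m
    v∈ : (U ∖ ⁅ u ⁆) v ≡ true
    v∈ = cong₂ (λ a b → a ∧ not b) (≡⇒∈unmatched G {m} mv≡v) (≢⇒==false (u≢v ∘ sym))

module _ {n} (G : SimpleGraph n) {P : Fin n → Set} (P? : ∀ v → Dec (P v))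
         (m m′ : Fin n → Fin n) where

  patch : Fin n → Fin n
  patch v with P? v
  ... | yes _ = m′ v
  ... | no _  = m v

  patch-perfect :
    (∀ v → m (m v) ≡ v) → (∀ v → P v → P (m v)) → (∀ v → ¬ P v → Adj G v (m v)) →
    (∀ v → P v → m′ (m′ v) ≡ v) → (∀ v → P v → P (m′ v)) → (∀ v → P v → Adj G v (m′ v)) →
    PerfectMatching G
  patch-perfect m-inv m-closed m-adj m′-inv m′-closed m′-adj = patch , adjacent , involutive
    where
    patch-in : ∀ v → P v → patch v ≡ m′ v
    patch-in v Pv with P? v
    ... | yes _  = refl
    ... | no ¬Pv = ⊥-elim (¬Pv Pv)
    patch-out : ∀ v → ¬ P v → patch v ≡ m v
    patch-out v ¬Pv with P? v
    ... | yes Pv = ⊥-elim (¬Pv Pv)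
    ... | no _   = refl
    adjacent : ∀ v → Adj G v (patch v)
    adjacent v with P? v
    ... | yes Pv  = m′-adj v Pv
    ... | no ¬Pv  = m-adj v ¬Pv
    involutive : ∀ v → patch (patch v) ≡ v
    involutive v with P? v
    ... | yes Pv  = trans (patch-in (m′ v) (m′-closed v Pv)) (m′-inv v Pv)
    ... | no ¬Pv  = trans (patch-out (m v) (λ Pmv → ¬Pv (subst P (m-inv v) (m-closed (m v) Pmv)))) (m-inv v)

module _ {n} (G : SimpleGraph n) (x y : Fin n) (x≢y : x ≢ y) where

  addEdge : SimpleGraph n
  addEdge = record { adj = adj′ ; symmetric = symmetric′ ; loopless = loopless′ }
    where
    adj′ : Fin n → Fin n → Bool
    adj′ u v = adj G u v ∨ ((u == x ∧ v == y) ∨ (u == y ∧ v == x))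
    symmetric′ : ∀ u v → adj′ u v ≡ adj′ v u
    symmetric′ u v rewrite symmetric G u v
      with u == x | v == y | u == y | v == x
    ... | a | b | c | d rewrite Bool.∧-comm a b | Bool.∧-comm c d =
      cong (adj G v u ∨_) (Bool.∨-comm (b ∧ a) (d ∧ c))
    loopless′ : ∀ v → adj′ v v ≡ false
    loopless′ v rewrite loopless G v with v Fin.≟ x | v Fin.≟ y
    ... | yes refl | yes v≡y = ⊥-elim (x≢y v≡y)
    ... | yes refl | no _    = refl
    ... | no _     | yes _   = refl
    ... | no _     | no _    = refl

  Adj-addEdge⁻ : ∀ {u v} → Adj addEdge u v → Adj G u v ⊎ (u ≡ x × v ≡ y) ⊎ (u ≡ y × v ≡ x)
  Adj-addEdge⁻ {u} {v} uv with ∨-true (adj G u v) uv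
  ... | inj₁ old = inj₁ old
  ... | inj₂ new with ∨-true (u == x ∧ v == y) new
  ...   | inj₁ xy = let ux , vy = ∧-true (u == x) xy in inj₂ (inj₁ (==⇒≡ ux , ==⇒≡ vy))
  ...   | inj₂ yx = let uy , vx = ∧-true (u == y) yx in inj₂ (inj₂ (==⇒≡ uy , ==⇒≡ vx))

  Adj-addEdge⁺ : ∀ {u v} → Adj G u v → Adj addEdge u v
  Adj-addEdge⁺ uv = cong (_∨ _) uv

  Adj-addEdge-new : Adj addEdge x y
  Adj-addEdge-new rewrite ==-refl x | ==-refl y = Bool.∨-zeroʳ _

∃-function? : ∀ n k (P : (Fin n → Fin k) → Set) → (∀ f → Dec (P f)) →
  (∀ f g → (∀ i → f i ≡ g i) → P f → P g) → Dec (Σ (Fin n → Fin k) P)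
∃-function? zero k P P? ext with P? (λ ())
... | yes p = yes (_ , p)
... | no ¬p = no λ { (f , pf) → ¬p (ext f _ (λ ()) pf) }
∃-function? (suc n) k P P? ext
  with Fin.any? (λ x → ∃-function? n k (P ∘ (x ∷_)) (P? ∘ (x ∷_))
                         λ f g f≗g → ext _ _ λ { zero → refl ; (suc i) → f≗g i })
... | yes (x , f , p) = yes (_ , p)
... | no ¬p = no λ { (f , pf) → ¬p (f zero , f ∘ suc , ext f _ (λ { zero → refl ; (suc i) → refl }) pf) }

perfectMatching? : ∀ {n} (G : SimpleGraph n) → Dec (PerfectMatching G)
perfectMatching? {n} G =
  ∃-function? n n _ (λ m → Fin.all? (λ v → adj G v (m v) Bool.≟ true) ×-dec Fin.all? (λ v → m (m v) Fin.≟ v))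
    λ f g f≗g (adjacent , involutive) →
      (λ v → subst (Adj G v) (f≗g v) (adjacent v)) ,
      (λ v → trans (cong g (sym (f≗g v))) (trans (sym (f≗g (f v))) (involutive v)))

-- Alternating cycles

iterate-suc : ∀ {A : Set} (f : A → A) x k → iterate f x (suc k) ≡ f (iterate f x k)
iterate-suc f x zero    = refl
iterate-suc f x (suc k) = iterate-suc f (f x) k

iterate-+ : ∀ {A : Set} (f : A → A) x j k → iterate f x (j + k) ≡ iterate f (iterate f x j) k
iterate-+ f x zero    k = refl
iterate-+ f x (suc j) k = iterate-+ f (f x) j k

least? : ∀ K {Q : ℕ → Set} → (∀ i → Dec (Q i)) →
  (∃ λ j → j < K × Q j × (∀ i → i < j → ¬ Q i)) ⊎ (∀ i → i < K → ¬ Q i)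
least? zero    Q? = inj₂ λ i ()
least? (suc K) Q? with least? K Q?
... | inj₁ (j , j<K , Qj , least) = inj₁ (j , m<n⇒m<1+n j<K , Qj , least)
... | inj₂ none with Q? K
...   | yes QK = inj₁ (K , n<1+n K , QK , none)
...   | no ¬QK = inj₂ λ i i<1+K → [ none i , (λ { refl → ¬QK }) ] (m<1+n⇒m<n∨m≡n i<1+K)

module InvolutionPair {n} (m₁ m₂ : Fin n → Fin n)
  (inv₁ : ∀ v → m₁ (m₁ v) ≡ v) (inv₂ : ∀ v → m₂ (m₂ v) ≡ v)
  (fixfree₁ : ∀ v → m₁ v ≢ v) (fixfree₂ : ∀ v → m₂ v ≢ v) where

  π ρ : Fin n → Fin n
  π = m₁ ∘ m₂
  ρ = m₂ ∘ m₁

  ρ∘π : ∀ v → ρ (π v) ≡ v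
  ρ∘π v = trans (cong m₂ (inv₁ (m₂ v))) (inv₂ v)

  π∘ρ : ∀ v → π (ρ v) ≡ v
  π∘ρ v = trans (cong m₁ (inv₂ (m₁ v))) (inv₁ v)

  π^-injective : ∀ k {v w} → iterate π v k ≡ iterate π w k → v ≡ w
  π^-injective zero    eq = eq
  π^-injective (suc k) {v} {w} eq = trans (sym (ρ∘π v)) (trans (cong ρ (π^-injective k eq)) (ρ∘π w))

  -- Alternating cycles have even length: an even number of steps cannot reach m₂ w from w.
  π^≢m₂ : ∀ k w → iterate π w k ≢ m₂ w
  π^≢m₂ zero          w eq = fixfree₂ w (sym eq)
  π^≢m₂ (suc zero)    w eq = fixfree₁ (m₂ w) eq
  π^≢m₂ (suc (suc k)) w eq = π^≢m₂ k (π w) (begin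
    iterate π (π w) k              ≡⟨ ρ∘π _ ⟨
    ρ (π (iterate π (π w) k))      ≡⟨ cong ρ (iterate-suc π (π w) k) ⟨
    ρ (iterate π w (suc (suc k)))  ≡⟨ cong ρ eq ⟩
    ρ (m₂ w)                       ∎)
    where open ≡-Reasoning

  m₂∘π^ : ∀ k w → m₂ (iterate π w k) ≡ iterate ρ (m₂ w) k
  m₂∘π^ zero    w = refl
  m₂∘π^ (suc k) w = m₂∘π^ k (π w)

  π^∘ρ^ : ∀ k w → iterate π (iterate ρ w k) k ≡ w
  π^∘ρ^ zero    w = refl
  π^∘ρ^ (suc k) w = trans (cong (λ x → iterate π x k) (trans (cong π (iterate-suc ρ w k)) (π∘ρ _))) (π^∘ρ^ k w)

  π^≢m₂∘π^ : ∀ p q w → iterate π w p ≢ m₂ (iterate π w q)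
  π^≢m₂∘π^ p q w eq = π^≢m₂ (p + q) w (begin
    iterate π w (p + q)                  ≡⟨ iterate-+ π w p q ⟩
    iterate π (iterate π w p) q          ≡⟨ cong (λ x → iterate π x q) (trans eq (m₂∘π^ q w)) ⟩
    iterate π (iterate ρ (m₂ w) q) q     ≡⟨ π^∘ρ^ q (m₂ w) ⟩
    m₂ w                                 ∎)
    where open ≡-Reasoning

  π^-return : ∀ w p e → iterate π w p ≡ iterate π w (p + e) → iterate π w e ≡ w
  π^-return w p e eq = sym (π^-injective p (trans eq (begin
    iterate π w (p + e)                ≡⟨ cong (iterate π w) (+-comm p e) ⟩
    iterate π w (e + p)                ≡⟨ iterate-+ π w e p ⟩
    iterate π (iterate π w e) p        ∎)))
    where open ≡-Reasoning

  π^-periodic : ∀ w e → iterate π w e ≡ w → ∀ t → iterate π w (e + t) ≡ iterate π w t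
  π^-periodic w e ret t = trans (iterate-+ π w e t) (cong (λ x → iterate π x t) ret)

  π-period : ∀ w → ∃ λ e → 0 < e × iterate π w e ≡ w
  π-period w with Fin.pigeonhole (n<1+n n) (iterate π w ∘ toℕ)
  ... | i , j , i<j , eq =
    toℕ j ∸ toℕ i , m<n⇒0<n∸m i<j ,
    π^-return w (toℕ i) _ (trans eq (cong (iterate π w) (sym (m+[n∸m]≡n (<⇒≤ i<j)))))

module AlternatingCycle {n} (G : SimpleGraph n) {a b c d : Fin n}
  (ab : Adj G a b) (bc : Adj G b c) (a≢c : a ≢ c) (b≢d : b ≢ d)
  {m₁ m₂ : Fin n → Fin n}
  (adj₁ : ∀ v → Adj (addEdge G a c a≢c) v (m₁ v)) (inv₁ : ∀ v → m₁ (m₁ v) ≡ v)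
  (adj₂ : ∀ v → Adj (addEdge G b d b≢d) v (m₂ v)) (inv₂ : ∀ v → m₂ (m₂ v) ≡ v)
  (m₁a≡c : m₁ a ≡ c) (m₂b≡d : m₂ b ≡ d) where

  open InvolutionPair m₁ m₂ inv₁ inv₂
    (λ v → Adj-irrefl (addEdge G a c a≢c) (adj₁ v) ∘ sym)
    (λ v → Adj-irrefl (addEdge G b d b≢d) (adj₂ v) ∘ sym)

  m₁c≡a : m₁ c ≡ a
  m₁c≡a = trans (cong m₁ (sym m₁a≡c)) (inv₁ a)

  Adj₁ : ∀ {v} → v ≢ a → v ≢ c → Adj G v (m₁ v)
  Adj₁ {v} v≢a v≢c with Adj-addEdge⁻ G a c a≢c (adj₁ v)
  ... | inj₁ old               = old
  ... | inj₂ (inj₁ (v≡a , _))  = ⊥-elim (v≢a v≡a)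
  ... | inj₂ (inj₂ (v≡c , _))  = ⊥-elim (v≢c v≡c)

  Adj₂ : ∀ {v} → v ≢ b → v ≢ d → Adj G v (m₂ v)
  Adj₂ {v} v≢b v≢d with Adj-addEdge⁻ G b d b≢d (adj₂ v)
  ... | inj₁ old               = old
  ... | inj₂ (inj₁ (v≡b , _))  = ⊥-elim (v≢b v≡b)
  ... | inj₂ (inj₂ (v≡d , _))  = ⊥-elim (v≢d v≡d)

  -- The alternating walk b = z 0, o 0 = d, z 1, o 1, … : m₂ joins z i to o i, m₁ joins o i to z (1 + i).
  z o : ℕ → Fin n
  z = iterate π b
  o i = m₂ (z i)

  m₁∘o : ∀ i → m₁ (o i) ≡ z (suc i)
  m₁∘o i = sym (iterate-suc π b i)

  m₁∘z : ∀ i → m₁ (z (suc i)) ≡ o i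
  m₁∘z i = trans (cong m₁ (iterate-suc π b i)) (inv₁ (o i))

  z≢o : ∀ p q → z p ≢ o q
  z≢o p q = π^≢m₂∘π^ p q b

  Hits : ℕ → Set
  Hits i = o i ≡ a ⊎ o i ≡ c

  Hits? : ∀ i → Dec (Hits i)
  Hits? i = (o i Fin.≟ a) ⊎-dec (o i Fin.≟ c)

  z-avoids : ∀ i → ¬ Hits i → z (suc i) ≢ a × z (suc i) ≢ c
  z-avoids i ¬hit =
    (λ z≡a → ¬hit (inj₂ (trans (sym (m₁∘z i)) (trans (cong m₁ z≡a) m₁a≡c)))) ,
    (λ z≡c → ¬hit (inj₁ (trans (sym (m₁∘z i)) (trans (cong m₁ z≡c) m₁c≡a))))

  OnWalk : ℕ → Fin n → Set
  OnWalk k v = ∃ λ i → i < k × (v ≡ z i ⊎ v ≡ o i)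

  OnWalk-m₂ : ∀ {k v} → OnWalk k v → OnWalk k (m₂ v)
  OnWalk-m₂ (i , i<k , inj₁ refl) = i , i<k , inj₂ refl
  OnWalk-m₂ (i , i<k , inj₂ refl) = i , i<k , inj₁ (inv₂ (z i))

  -- Away from the walk m₂ is a matching of G: its only new edge b d lies on the walk.
  perfectOnWalk : ∀ k (m₁′ : Fin n → Fin n) → 0 < k →
    (∀ v → OnWalk k v → m₁′ (m₁′ v) ≡ v) → (∀ v → OnWalk k v → OnWalk k (m₁′ v)) →
    (∀ v → OnWalk k v → Adj G v (m₁′ v)) → PerfectMatching G
  perfectOnWalk k m₁′ 0<k =
    patch-perfect G (λ v → anyUpTo? (λ i → (v Fin.≟ z i) ⊎-dec (v Fin.≟ o i)) k)
      m₂ m₁′ inv₂ (λ _ → OnWalk-m₂) outside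
    where
    outside : ∀ v → ¬ OnWalk k v → Adj G v (m₂ v)
    outside v ¬on = Adj₂ (λ { refl → ¬on (0 , 0<k , inj₁ refl) })
                         (λ { refl → ¬on (0 , 0<k , inj₂ (sym m₂b≡d)) })

  perfect-if-cycle-avoids-ac : ∀ e → 0 < e → z e ≡ b → (∀ i → i < e → ¬ Hits i) → PerfectMatching G
  perfect-if-cycle-avoids-ac (suc e) 0<e ze≡b avoids =
    perfectOnWalk (suc e) m₁ 0<e (λ v _ → inv₁ v) closed adjacent
    where
    closed : ∀ v → OnWalk (suc e) v → OnWalk (suc e) (m₁ v)
    closed v (i , i<e , inj₂ refl) with m<1+n⇒m<n∨m≡n (s≤s i<e)
    ... | inj₁ 1+i<e = suc i , 1+i<e , inj₁ (m₁∘o i)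
    ... | inj₂ refl  = 0 , 0<e , inj₁ (trans (m₁∘o i) ze≡b)
    closed v (zero , _ , inj₁ refl) = e , n<1+n e , inj₂ (trans (cong m₁ (sym ze≡b)) (m₁∘z e))
    closed v (suc i , i<e , inj₁ refl) = i , <-trans (n<1+n i) i<e , inj₂ (m₁∘z i)
    adjacent : ∀ v → OnWalk (suc e) v → Adj G v (m₁ v)
    adjacent v (i , i<e , inj₂ refl) = Adj₁ (avoids i i<e ∘ inj₁) (avoids i i<e ∘ inj₂)
    adjacent v (zero , _ , inj₁ refl) = Adj₁ (Adj-irrefl G ab ∘ sym) (Adj-irrefl G bc)
    adjacent v (suc i , i<e , inj₁ refl) =
      let z≢a , z≢c = z-avoids i (avoids i (<-trans (n<1+n i) i<e)) in Adj₁ z≢a z≢c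

  -- Shortcut the walk at its first visit o j to a or c, both of which are adjacent to b.
  perfect-if-walk-hits-ac : ∀ j → Hits j → (∀ i → i < j → ¬ Hits i) → PerfectMatching G
  perfect-if-walk-hits-ac j hit first = perfectOnWalk (suc j) m₃ (s≤s z≤n) involutive closed adjacent
    where
    m₃ = matchPair m₁ (o j) b

    oj≢b : o j ≢ b
    oj≢b = z≢o 0 j ∘ sym

    ojb : Adj G (o j) b
    ojb = [ (λ oj≡a → subst (λ x → Adj G x b) (sym oj≡a) ab) ,
            (λ oj≡c → subst (λ x → Adj G x b) (sym oj≡c) (Adj-sym G bc)) ] hit

    z≢b : ∀ i → 0 < i → i ≤ j → z i ≢ b
    z≢b i 0<i i≤j zi≡b = first (j ∸ i) (∸-monoʳ-< 0<i i≤j)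
      (subst (λ x → x ≡ a ⊎ x ≡ c)
        (trans (cong o (sym (m+[n∸m]≡n i≤j))) (cong m₂ (π^-periodic b i zi≡b (j ∸ i)))) hit)

    o-injective : ∀ p q → p < q → q ≤ j → o p ≢ o q
    o-injective p q p<q q≤j op≡oq = z≢b (q ∸ p) (m<n⇒0<n∸m p<q) (≤-trans (m∸n≤m q p) q≤j)
      (π^-return b p (q ∸ p) (trans (trans (sym (inv₂ _)) (cong m₂ op≡oq))
                                    (trans (inv₂ _) (cong z (sym (m+[n∸m]≡n (<⇒≤ p<q)))))))

    inner : ∀ v → OnWalk (suc j) v → v ≢ o j → v ≢ b →
      (∃ λ i → i < j × v ≡ o i) ⊎ (∃ λ i → i < j × v ≡ z (suc i))
    inner v (zero , _ , inj₁ refl) _ v≢b = ⊥-elim (v≢b refl)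
    inner v (suc i , 1+i≤j , inj₁ refl) _ _ = inj₂ (i , ≤-pred 1+i≤j , refl)
    inner v (i , i≤j , inj₂ refl) v≢oj _ with m<1+n⇒m<n∨m≡n i≤j
    ... | inj₁ i<j = inj₁ (i , i<j , refl)
    ... | inj₂ refl = ⊥-elim (v≢oj refl)

    inner-m₁ : ∀ v → OnWalk (suc j) v → v ≢ o j → v ≢ b →
      OnWalk (suc j) (m₁ v) × m₁ v ≢ o j × m₁ v ≢ b × v ≢ a × v ≢ c
    inner-m₁ v on v≢oj v≢b with inner v on v≢oj v≢b
    ... | inj₁ (i , i<j , refl) rewrite m₁∘o i =
          (suc i , s≤s i<j , inj₁ refl) , z≢o (suc i) j , z≢b (suc i) (s≤s z≤n) i<j ,
          first i i<j ∘ inj₁ , first i i<j ∘ inj₂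
    ... | inj₂ (i , i<j , refl) rewrite m₁∘z i =
          (i , m<n⇒m<1+n i<j , inj₂ refl) , o-injective i j i<j ≤-refl , z≢o 0 i ∘ sym ,
          z-avoids i (first i i<j)

    oj∈ : OnWalk (suc j) (o j)
    oj∈ = j , n<1+n j , inj₂ refl

    closed : ∀ v → OnWalk (suc j) v → OnWalk (suc j) (m₃ v)
    closed v on with v Fin.≟ o j
    ... | yes refl rewrite matchPair-u m₁ (o j) b = 0 , s≤s z≤n , inj₁ refl
    ... | no v≢oj with v Fin.≟ b
    ...   | yes refl rewrite matchPair-v m₁ (o j) b oj≢b = oj∈
    ...   | no v≢b rewrite matchPair-other m₁ (o j) b v v≢oj v≢b = proj₁ (inner-m₁ v on v≢oj v≢b)

    involutive : ∀ v → OnWalk (suc j) v → m₃ (m₃ v) ≡ v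
    involutive v on with v Fin.≟ o j
    ... | yes refl rewrite matchPair-u m₁ (o j) b = matchPair-v m₁ (o j) b oj≢b
    ... | no v≢oj with v Fin.≟ b
    ...   | yes refl rewrite matchPair-v m₁ (o j) b oj≢b = matchPair-u m₁ (o j) b
    ...   | no v≢b with inner-m₁ v on v≢oj v≢b
    ...     | _ , m₁v≢oj , m₁v≢b , _
            rewrite matchPair-other m₁ (o j) b v v≢oj v≢b
                  | matchPair-other m₁ (o j) b (m₁ v) m₁v≢oj m₁v≢b = inv₁ v

    adjacent : ∀ v → OnWalk (suc j) v → Adj G v (m₃ v)
    adjacent v on with v Fin.≟ o j
    ... | yes refl rewrite matchPair-u m₁ (o j) b = ojb
    ... | no v≢oj with v Fin.≟ b
    ...   | yes refl rewrite matchPair-v m₁ (o j) b oj≢b = Adj-sym G ojb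
    ...   | no v≢b with inner-m₁ v on v≢oj v≢b
    ...     | _ , _ , _ , v≢a , v≢c rewrite matchPair-other m₁ (o j) b v v≢oj v≢b = Adj₁ v≢a v≢c

  perfectMatching : PerfectMatching G
  perfectMatching with π-period b
  ... | e , 0<e , ze≡b with least? e Hits?
  ...   | inj₂ avoids = perfect-if-cycle-avoids-ac e 0<e ze≡b avoids
  ...   | inj₁ (j , _ , hit , first) = perfect-if-walk-hits-ac j hit first

perfect-without-new-edge : ∀ {n} (G : SimpleGraph n) {x y} (x≢y : x ≢ y) →
  ((m , _) : PerfectMatching (addEdge G x y x≢y)) → m x ≢ y → PerfectMatching G
perfect-without-new-edge G {x} {y} x≢y (m , adjacent , involutive) mx≢y = m , adjacent′ , involutive
  where
  adjacent′ : ∀ v → Adj G v (m v)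
  adjacent′ v with Adj-addEdge⁻ G x y x≢y (adjacent v)
  ... | inj₁ old               = old
  ... | inj₂ (inj₁ (refl , mv≡y)) = ⊥-elim (mx≢y mv≡y)
  ... | inj₂ (inj₂ (refl , mv≡x)) = ⊥-elim (mx≢y (trans (cong m (sym mv≡x)) (involutive v)))

perfect-from-two-extensions : ∀ {n} (G : SimpleGraph n) {a b c d} → Adj G a b → Adj G b c →
  (a≢c : a ≢ c) (b≢d : b ≢ d) →
  PerfectMatching (addEdge G a c a≢c) → PerfectMatching (addEdge G b d b≢d) → PerfectMatching G
perfect-from-two-extensions G {a} {b} {c} {d} ab bc a≢c b≢d M₁@(m₁ , adj₁ , inv₁) M₂@(m₂ , adj₂ , inv₂)
  with m₁ a Fin.≟ c | m₂ b Fin.≟ d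
... | no m₁a≢c | _ = perfect-without-new-edge G a≢c M₁ m₁a≢c
... | yes _ | no m₂b≢d = perfect-without-new-edge G b≢d M₂ m₂b≢d
... | yes m₁a≡c | yes m₂b≡d =
  AlternatingCycle.perfectMatching G ab bc a≢c b≢d adj₁ inv₁ adj₂ inv₂ m₁a≡c m₂b≡d

-- Tutte's theorem

module _ {n} (G : SimpleGraph n) where

  closedNbhd : Fin n → Subset n
  closedNbhd w v = (w == v) ∨ adj G w v

  closedNbhd-cases : ∀ {w v} → closedNbhd w v ≡ true → w ≡ v ⊎ Adj G w v
  closedNbhd-cases {w} {v} wv with w Fin.≟ v
  ... | yes w≡v = inj₁ w≡v
  ... | no _    = inj₂ wv

  Adj⇒closedNbhd : ∀ {w v} → Adj G w v → closedNbhd w v ≡ true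
  Adj⇒closedNbhd wv rewrite wv = Bool.∨-zeroʳ _

  closedNbhd-refl : ∀ w → closedNbhd w w ≡ true
  closedNbhd-refl w rewrite ==-refl w = refl

  universal : Subset n
  universal v = ⌊ Fin.all? (λ w → closedNbhd v w Bool.≟ true) ⌋

  universal⇒Adj : ∀ {v} → universal v ≡ true → ∀ {w} → v ≢ w → Adj G v w
  universal⇒Adj {v} univ {w} v≢w with Fin.all? (λ w → closedNbhd v w Bool.≟ true)
  ... | yes all = subst (λ b → b ∨ adj G v w ≡ true) (≢⇒==false v≢w) (all w)

  ¬universal⇒nonAdj : ∀ {v} → universal v ≡ false → ∃ λ d → v ≢ d × adj G v d ≡ false
  ¬universal⇒nonAdj {v} ¬univ with Fin.all? (λ w → closedNbhd v w Bool.≟ true)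
  ... | no ¬all with Fin.¬∀⟶∃¬ n _ (λ w → closedNbhd v w Bool.≟ true) ¬all
  ...   | d , ¬vd with v Fin.≟ d | adj G v d in vd
  ...     | yes refl | _     = ⊥-elim (¬vd refl)
  ...     | no v≢d   | false = d , v≢d , vd
  ...     | no _     | true  = ⊥-elim (¬vd refl)

∖-remove-member : ∀ {n} (X Y : Subset n) {t} → Y t ≡ true → ∀ u w →
  (((X ∖ ⁅ t ⁆) ∖ ⁅ u ⁆) ∖ Y) w ≡ ((X ∖ Y) ∖ ⁅ u ⁆) w
∖-remove-member X Y {t} Yt u w = lemma (X w) (w == t) (w == u) (Y w) λ w≡t → trans (cong Y (==⇒≡ w≡t)) Yt
  where
  lemma : ∀ f x y z → (x ≡ true → z ≡ true) → ((f ∧ not x) ∧ not y) ∧ not z ≡ (f ∧ not z) ∧ not y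
  lemma false x     y     z     _   = refl
  lemma true  true  y     z     x⇒z rewrite x⇒z refl = refl
  lemma true  false true  z     _   = sym (Bool.∧-zeroʳ _)
  lemma true  false false z     _   = sym (Bool.∧-identityʳ _)

∩-remove-nonmember : ∀ {n} (X Y : Subset n) t {u} → Y u ≡ false → ∀ w →
  (((X ∖ ⁅ t ⁆) ∖ ⁅ u ⁆) ∩ Y) w ≡ ((X ∩ Y) ∖ ⁅ t ⁆) w
∩-remove-nonmember X Y t {u} Yu w = lemma (X w) (w == t) (w == u) (Y w) λ w≡u → trans (cong Y (==⇒≡ w≡u)) Yu
  where
  lemma : ∀ f x y z → (y ≡ true → z ≡ false) → ((f ∧ not x) ∧ not y) ∧ z ≡ (f ∧ z) ∧ not x
  lemma false x     y     z     _   = refl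
  lemma true  x     true  z     y⇒¬z rewrite y⇒¬z refl = Bool.∧-zeroʳ _
  lemma true  true  false z     _   = sym (Bool.∧-zeroʳ _)
  lemma true  false false z     _   = sym (Bool.∧-identityʳ z)

∩-nonempty : ∀ {n} (X Y : Subset n) → 0 < ∣ X ∣ → ∣ X ∖ Y ∣ ≤ ∣ X ∩ Y ∣ → 0 < ∣ X ∩ Y ∣
∩-nonempty X Y 0<∣X∣ few with ∣ X ∩ Y ∣ in eq
... | suc _ = s≤s z≤n
... | zero  = subst (0 <_) (trans (∣∣-split X Y) (cong₂ _+_ eq (n≤0⇒n≡0 few))) 0<∣X∣

module _ {n} (G : SimpleGraph n) (n-even : odd n ≡ false) where

  -- Match unmatched universal vertices to the remaining unmatched vertices, two at a time.
  perfect-if-few-nonuniversal : ∀ {m} → PartialMatching G m →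
    ∣ unmatched G m ∖ universal G ∣ ≤ ∣ unmatched G m ∩ universal G ∣ → PerfectMatching G
  perfect-if-few-nonuniversal {m} = go ∣ unmatched G m ∣ m ≤-refl
    where
    go : ∀ fuel m → ∣ unmatched G m ∣ ≤ fuel → PartialMatching G m →
      ∣ unmatched G m ∖ universal G ∣ ≤ ∣ unmatched G m ∩ universal G ∣ → PerfectMatching G
    advance : ∀ fuel {m} → ∣ unmatched G m ∣ ≤ suc fuel → PartialMatching G m →
      ∀ {t u} → unmatched G m t ≡ true → universal G t ≡ true → unmatched G m u ≡ true → u ≢ t →
      (∣ unmatched G (matchPair m t u) ∖ universal G ∣ ≤ ∣ unmatched G (matchPair m t u) ∩ universal G ∣) →
      PerfectMatching G
    advance fuel {m} ≤fuel pm Ut univ-t Uu u≢t =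
      go fuel _ (≤-pred (≤-trans (≤-trans (n≤1+n _) (≤-reflexive (sym ∣U′∣))) ≤fuel))
        (matchPair-partialMatching G pm (==⇒≡ Ut) (==⇒≡ Uu) tu)
      where
      tu = universal⇒Adj G univ-t (u≢t ∘ sym)
      ∣U′∣ = ∣unmatched∣-matchPair G pm (==⇒≡ Ut) (==⇒≡ Uu) tu

    go fuel m ≤fuel pm few with ∣ unmatched G m ∣ in ∣U∣≡
    ... | zero = perfect G pm λ v mv≡v →
          <-irrefl (sym ∣U∣≡) (∈⇒∣∣>0 (unmatched G m) (≡⇒∈unmatched G {m} mv≡v))
    go zero m () pm few | suc k
    go (suc fuel) m ≤fuel pm few | suc k
      with ∣∣>0⇒∈ (unmatched G m ∩ universal G)
             (∩-nonempty (unmatched G m) (universal G) (subst (0 <_) (sym ∣U∣≡) (s≤s z≤n)) few)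
    ... | t , t∈ with ∧-true (unmatched G m t) t∈ | ∣ unmatched G m ∖ universal G ∣ in ∣U∖univ∣≡
    ...   | Ut , univ-t | zero
      with ∣∣>0⇒∈ (unmatched G m ∖ ⁅ t ⁆)
             (subst (0 <_) (suc-injective (trans (sym ∣U∣≡) (∣∣-remove (unmatched G m) Ut)))
               (even-suc⇒pos k (subst (λ s → odd s ≡ false) ∣U∣≡ (∣unmatched∣-even G n-even pm))))
    ...     | u , u∈ with ∧-true (unmatched G m u) u∈
    ...       | Uu , u≠t =
      advance fuel (subst (_≤ suc fuel) (sym ∣U∣≡) ≤fuel) pm Ut univ-t Uu u≢t
        (≤-trans (∣∣-mono U′∖univ⊆U∖univ) (subst (_≤ ∣ U′ ∩ universal G ∣) (sym ∣U∖univ∣≡) z≤n))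
      where
      u≢t : u ≢ t
      u≢t refl = Bool.not-¬ (==-refl u) (Bool.not-injective u≠t)
      U′ = unmatched G (matchPair m t u)
      U′∖univ⊆U∖univ : (U′ ∖ universal G) ⊆ (unmatched G m ∖ universal G)
      U′∖univ⊆U∖univ w U′w∖univ = let U′w , ¬univ-w = ∧-true (U′ w) U′w∖univ in
        cong₂ _∧_ (unmatched-matchPair-⊆ G pm (==⇒≡ Ut) (==⇒≡ Uu) (universal⇒Adj G univ-t (u≢t ∘ sym)) w U′w) ¬univ-w
    go (suc fuel) m ≤fuel pm few | suc k | t , t∈ | Ut , univ-t | suc x
      with ∣∣>0⇒∈ (unmatched G m ∖ universal G) (subst (0 <_) (sym ∣U∖univ∣≡) (s≤s z≤n))
    ...     | u , u∈ with ∧-true (unmatched G m u) u∈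
    ...       | Uu , ¬univ-u =
      advance fuel (subst (_≤ suc fuel) (sym ∣U∣≡) ≤fuel) pm Ut univ-t Uu u≢t (≤-pred (begin
        suc ∣ U′ ∖ univ ∣              ≡⟨ cong suc (∣∣-cong λ w → trans (cong (λ b → b ∧ not (univ w)) (U′≡ w))
                                                                   (∖-remove-member U univ univ-t u w)) ⟩
        suc ∣ (U ∖ univ) ∖ ⁅ u ⁆ ∣     ≡⟨ trans (sym (∣∣-remove (U ∖ univ) u∈)) ∣U∖univ∣≡ ⟩
        suc x                          ≤⟨ few ⟩
        ∣ U ∩ univ ∣                   ≡⟨ ∣∣-remove (U ∩ univ) t∈ ⟩
        suc ∣ (U ∩ univ) ∖ ⁅ t ⁆ ∣     ≡⟨ cong suc (∣∣-cong λ w → trans (cong (λ b → b ∧ univ w) (U′≡ w))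
                                                                   (∩-remove-nonmember U univ t ¬univ-u′ w)) ⟨
        suc ∣ U′ ∩ univ ∣              ∎))
      where
      open ≤-Reasoning
      U = unmatched G m
      univ = universal G
      ¬univ-u′ = Bool.not-injective ¬univ-u
      u≢t : u ≢ t
      u≢t refl = Bool.not-¬ univ-t ¬univ-u′
      U′ = unmatched G (matchPair m t u)
      U′≡ = unmatched-matchPair G pm (==⇒≡ Ut) (==⇒≡ Uu) (universal⇒Adj G univ-t (u≢t ∘ sym))

ClosedOutside : ∀ {n} → SimpleGraph n → Subset n → Subset n → Set
ClosedOutside G S H = ∀ u v → H u ≡ true → Adj G u v → S v ≡ false → H v ≡ true

record OddParts {n} (G : SimpleGraph n) (S X : Subset n) : Set where
  field
    R          : Subset n
    C          : Fin n → Subset n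
    C-⊆        : ∀ w → R w ≡ true → C w ⊆ X
    C-avoids-S : ∀ w → R w ≡ true → ∀ v → C w v ≡ true → S v ≡ false
    C-disjoint : ∀ w w′ → R w ≡ true → R w′ ≡ true → w ≢ w′ → ∀ v → C w v ≡ true → C w′ v ≡ false
    C-closed   : ∀ w → R w ≡ true → ClosedOutside G S (C w)
    C-odd      : ∀ w → R w ≡ true → odd ∣ C w ∣ ≡ true

record Barrier {n} (G : SimpleGraph n) : Set where
  field
    S         : Subset n
    parts     : OddParts G S full
    deficient : ∣ S ∣ + 2 ≤ ∣ OddParts.R parts ∣

barrier-addEdge⁻ : ∀ {n} (G : SimpleGraph n) x y x≢y → Barrier (addEdge G x y x≢y) → Barrier G
barrier-addEdge⁻ G x y x≢y B = record
  { S = S ; deficient = deficient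
  ; parts = record
    { R = R ; C = C ; C-⊆ = C-⊆ ; C-avoids-S = C-avoids-S ; C-disjoint = C-disjoint ; C-odd = C-odd
    ; C-closed = λ w Rw u v Cu uv → C-closed w Rw u v Cu (Adj-addEdge⁺ G x y x≢y uv) } }
  where
  open Barrier B
  open OddParts parts

module Saturated {n} (G : SimpleGraph n) (n-even : odd n ≡ false) (¬pm : ¬ PerfectMatching G)
  (saturated : ∀ x y (x≢y : x ≢ y) → adj G x y ≡ false → PerfectMatching (addEdge G x y x≢y)) where

  Adj-through-nonuniversal : ∀ {a b c} → Adj G a b → Adj G b c → a ≢ c → universal G b ≡ false → Adj G a c
  Adj-through-nonuniversal {a} {b} {c} ab bc a≢c ¬univ-b with adj G a c in ac
  ... | true  = refl
  ... | false with ¬universal⇒nonAdj G ¬univ-b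
  ...   | d , b≢d , bd = ⊥-elim (¬pm (perfect-from-two-extensions G ab bc a≢c b≢d
                                        (saturated a c a≢c ac) (saturated b d b≢d bd)))

  Candidate : (Fin n → Fin n) → Fin n → Fin n → Set
  Candidate m u v = m u ≡ u × m v ≡ v × universal G u ≡ false × universal G v ≡ false × Adj G u v

  record Greedy (m : Fin n → Fin n) : Set where
    field
      partial             : PartialMatching G m
      universal-unmatched : ∀ v → universal G v ≡ true → m v ≡ v
      maximal             : ∀ u v → ¬ Candidate m u v

  greedy : Σ (Fin n → Fin n) Greedy
  greedy = go ∣ unmatched G id ∣ id ≤-refl
    (record { involutive = λ _ → refl ; matched = λ _ → inj₁ refl }) (λ _ _ → refl)
    where
    id : Fin n → Fin n
    id v = v
    candidate? : ∀ m u v → Dec (Candidate m u v)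
    candidate? m u v = (m u Fin.≟ u) ×-dec (m v Fin.≟ v) ×-dec (universal G u Bool.≟ false)
                       ×-dec (universal G v Bool.≟ false) ×-dec (adj G u v Bool.≟ true)
    go : ∀ fuel m → ∣ unmatched G m ∣ ≤ fuel → PartialMatching G m →
      (∀ v → universal G v ≡ true → m v ≡ v) → Σ (Fin n → Fin n) Greedy
    go fuel m ≤fuel pm univ-unmatched with Fin.any? (λ u → Fin.any? (candidate? m u))
    ... | no none = m , record { partial = pm ; universal-unmatched = univ-unmatched
                               ; maximal = λ u v cand → none (u , v , cand) }
    ... | yes (u , v , mu , mv , ¬univ-u , ¬univ-v , uv) with fuel
    ...   | zero = ⊥-elim (<-irrefl refl (≤-trans (∈⇒∣∣>0 (unmatched G m) (≡⇒∈unmatched G {m} mu)) ≤fuel))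
    ...   | suc fuel = go fuel (matchPair m u v)
              (≤-pred (≤-trans (≤-trans (n≤1+n _) (≤-reflexive (sym (∣unmatched∣-matchPair G pm mu mv uv)))) ≤fuel))
              (matchPair-partialMatching G pm mu mv uv)
              λ w univ-w → trans (matchPair-other m u v w (≢-universal univ-w ¬univ-u) (≢-universal univ-w ¬univ-v))
                                 (univ-unmatched w univ-w)
      where
      ≢-universal : ∀ {w x} → universal G w ≡ true → universal G x ≡ false → w ≢ x
      ≢-universal univ-w ¬univ-x refl = Bool.not-¬ univ-w ¬univ-x

  barrier : ∀ {m} → Greedy m → ¬ (∣ unmatched G m ∖ universal G ∣ ≤ ∣ unmatched G m ∩ universal G ∣) → Barrier G
  barrier {m} gr many = record
    { S = universal G ; deficient = deficient
    ; parts = record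
      { R = unmatched G m ∖ universal G ; C = C ; C-⊆ = λ _ _ _ _ → refl
      ; C-avoids-S = λ w _ v Cwv → Bool.not-injective (proj₂ (∧-true _ Cwv))
      ; C-disjoint = C-disjoint ; C-closed = C-closed ; C-odd = C-odd } }
    where
    open Greedy gr
    open PartialMatching partial
    U = unmatched G m
    univ = universal G
    C : Fin n → Subset n
    C w = closedNbhd G w ∖ univ

    R⇒ : ∀ {w} → (U ∖ univ) w ≡ true → m w ≡ w × univ w ≡ false
    R⇒ Rw = let Uw , ¬univ-w = ∧-true _ Rw in ==⇒≡ Uw , Bool.not-injective ¬univ-w

    C⇒ : ∀ {w v} → C w v ≡ true → (w ≡ v ⊎ Adj G w v) × univ v ≡ false
    C⇒ Cwv = let N , ¬univ = ∧-true _ Cwv in closedNbhd-cases G N , Bool.not-injective ¬univ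

    ⇒C : ∀ {w v} → (w ≡ v ⊎ Adj G w v) → univ v ≡ false → C w v ≡ true
    ⇒C (inj₁ refl) ¬univ = cong₂ (λ a b → a ∧ not b) (closedNbhd-refl G _) ¬univ
    ⇒C (inj₂ wv)   ¬univ = cong₂ (λ a b → a ∧ not b) (Adj⇒closedNbhd G wv) ¬univ

    C-disjoint : ∀ w w′ → (U ∖ univ) w ≡ true → (U ∖ univ) w′ ≡ true → w ≢ w′ →
      ∀ v → C w v ≡ true → C w′ v ≡ false
    C-disjoint w w′ Rw Rw′ w≢w′ v Cwv = Bool.¬-not {y = true} λ Cw′v →
      maximal w w′ (proj₁ (R⇒ Rw) , proj₁ (R⇒ Rw′) , proj₂ (R⇒ Rw) , proj₂ (R⇒ Rw′) , ww′ (C⇒ Cwv) (C⇒ Cw′v))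
      where
      ww′ : (w ≡ v ⊎ Adj G w v) × univ v ≡ false → (w′ ≡ v ⊎ Adj G w′ v) × univ v ≡ false → Adj G w w′
      ww′ (inj₁ refl , _)      (inj₁ refl , _) = ⊥-elim (w≢w′ refl)
      ww′ (inj₁ refl , _)      (inj₂ w′w , _)  = Adj-sym G w′w
      ww′ (inj₂ wv , _)        (inj₁ refl , _) = wv
      ww′ (inj₂ wv , ¬univ-v)  (inj₂ w′v , _)  = Adj-through-nonuniversal wv (Adj-sym G w′v) w≢w′ ¬univ-v

    C-closed : ∀ w → (U ∖ univ) w ≡ true → ClosedOutside G univ (C w)
    C-closed w _ u v Cwu uv ¬univ-v with C⇒ Cwu
    ... | inj₁ refl , _ = ⇒C (inj₂ uv) ¬univ-v
    ... | inj₂ wu , ¬univ-u = by-cases (w Fin.≟ v)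
      where
      by-cases : Dec (w ≡ v) → C w v ≡ true
      by-cases (yes w≡v) = ⇒C (inj₁ w≡v) ¬univ-v
      by-cases (no w≢v)  = ⇒C (inj₂ (Adj-through-nonuniversal wu uv w≢v ¬univ-u)) ¬univ-v

    -- m pairs up the vertices of C w other than w itself.
    C-odd : ∀ w → (U ∖ univ) w ≡ true → odd ∣ C w ∣ ≡ true
    C-odd w Rw = trans (cong odd (∣∣-remove (C w) (⇒C (inj₁ refl) ¬univ-w)))
                       (cong not (involution-even m X closed fixfree (λ v _ → involutive v)))
      where
      mw≡w = proj₁ (R⇒ Rw)
      ¬univ-w = proj₂ (R⇒ Rw)
      X = C w ∖ ⁅ w ⁆
      X⇒ : ∀ {v} → X v ≡ true → Adj G w v × univ v ≡ false × v ≢ w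
      X⇒ {v} Xv with ∧-true (C w v) Xv
      ... | Cwv , v≠w with C⇒ Cwv
      ...   | inj₁ refl , _    = ⊥-elim (Bool.not-¬ (==-refl w) (Bool.not-injective v≠w) )
      ...   | inj₂ wv , ¬univ-v = wv , ¬univ-v , λ { refl → Bool.not-¬ (==-refl w) (Bool.not-injective v≠w) }
      fixfree : ∀ v → X v ≡ true → m v ≢ v
      fixfree v Xv mv≡v = let wv , ¬univ-v , _ = X⇒ Xv in maximal w v (mw≡w , mv≡v , ¬univ-w , ¬univ-v , wv)
      closed : ∀ v → X v ≡ true → X (m v) ≡ true
      closed v Xv = cong₂ _∧_ (⇒C (inj₂ w-mv) ¬univ-mv) (cong not (≢⇒==false mv≢w))
        where
        wv = proj₁ (X⇒ Xv)
        mv≢w : m v ≢ w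
        mv≢w mv≡w = proj₂ (proj₂ (X⇒ Xv)) (trans (sym (involutive v)) (trans (cong m mv≡w) mw≡w))
        v-mv : Adj G v (m v)
        v-mv = [ (λ mv≡v → ⊥-elim (fixfree v Xv mv≡v)) , (λ adj → adj) ] (matched v)
        ¬univ-mv : univ (m v) ≡ false
        ¬univ-mv = Bool.¬-not {y = true} λ univ-mv → fixfree v Xv (trans (sym (universal-unmatched (m v) univ-mv)) (involutive v))
        w-mv : Adj G w (m v)
        w-mv = Adj-through-nonuniversal wv v-mv (mv≢w ∘ sym) (proj₁ (proj₂ (X⇒ Xv)))

    deficient : ∣ univ ∣ + 2 ≤ ∣ U ∖ univ ∣
    deficient = subst (λ s → s + 2 ≤ ∣ U ∖ univ ∣) ∣U∩univ∣≡∣univ∣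
      (even-sum-<⇒+2≤ (subst (λ s → odd s ≡ false) (∣∣-split U univ) (∣unmatched∣-even G n-even partial))
                      (≰⇒> many))
      where
      ∣U∩univ∣≡∣univ∣ : ∣ U ∩ univ ∣ ≡ ∣ univ ∣
      ∣U∩univ∣≡∣univ∣ = ∣∣-cong λ w → lemma (univ w) refl
        where
        lemma : ∀ {w} b → univ w ≡ b → U w ∧ b ≡ b
        lemma {w} true  univ-w = cong (_∧ true) (≡⇒∈unmatched G {m} (universal-unmatched w univ-w))
        lemma     false _      = Bool.∧-zeroʳ _

  saturated-barrier : Barrier G
  saturated-barrier with greedy
  ... | m , gr with ∣ unmatched G m ∖ universal G ∣ ≤? ∣ unmatched G m ∩ universal G ∣
  ...   | yes few  = ⊥-elim (¬pm (perfect-if-few-nonuniversal G n-even (Greedy.partial gr) few))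
  ...   | no many  = barrier gr many

nonEdges : ∀ {n} → SimpleGraph n → ℕ
nonEdges G = sum λ u → sum λ v → bit (not (adj G u v) ∧ not (u == v))

nonEdges-addEdge : ∀ {n} (G : SimpleGraph n) x y (x≢y : x ≢ y) → adj G x y ≡ false →
  nonEdges (addEdge G x y x≢y) < nonEdges G
nonEdges-addEdge G x y x≢y ¬xy =
  sum-mono-< (λ u → sum-mono-≤ (fewer u)) x (sum-mono-< (fewer x) y xy-removed)
  where
  G′ = addEdge G x y x≢y
  fewer : ∀ u v → bit (not (adj G′ u v) ∧ not (u == v)) ≤ bit (not (adj G u v) ∧ not (u == v))
  fewer u v = bit-mono λ h → let ¬uv′ , u≠v = ∧-true _ h in
    cong₂ _∧_ (cong not (Bool.¬-not {y = true} λ uv → Bool.not-¬ (Adj-addEdge⁺ G x y x≢y uv) (Bool.not-injective ¬uv′))) u≠v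
  xy-removed : bit (not (adj G′ x y) ∧ not (x == y)) < bit (not (adj G x y) ∧ not (x == y))
  xy-removed rewrite Adj-addEdge-new G x y x≢y | ¬xy | ≢⇒==false x≢y = s≤s z≤n

-- Saturate G by adding edges that keep it free of perfect matchings.
tutte : ∀ {n} (G : SimpleGraph n) → odd n ≡ false → ¬ PerfectMatching G → Barrier G
tutte G = go (nonEdges G) G ≤-refl
  where
  Extendable : ∀ {n} → SimpleGraph n → Fin n → Fin n → Set
  Extendable G x y = Σ (x ≢ y) λ x≢y → adj G x y ≡ false × ¬ PerfectMatching (addEdge G x y x≢y)
  extendable? : ∀ {n} (G : SimpleGraph n) x y → Dec (Extendable G x y)
  extendable? G x y with x Fin.≟ y
  ... | yes x≡y = no λ (x≢y , _) → x≢y x≡y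
  ... | no x≢y with adj G x y Bool.≟ false | perfectMatching? (addEdge G x y x≢y)
  ...   | yes ¬xy | no ¬pm = yes (x≢y , ¬xy , ¬pm)
  ...   | no xy   | _      = no λ (_ , ¬xy , _) → xy ¬xy
  ...   | yes _   | yes pm = no λ (_ , _ , ¬pm) → ¬pm pm
  go : ∀ {n} fuel (G : SimpleGraph n) → nonEdges G ≤ fuel → odd n ≡ false → ¬ PerfectMatching G → Barrier G
  go fuel G ≤fuel n-even ¬pm with Fin.any? (λ x → Fin.any? (extendable? G x))
  ... | no none = Saturated.saturated-barrier G n-even ¬pm saturated
    where
    saturated : ∀ x y (x≢y : x ≢ y) → adj G x y ≡ false → PerfectMatching (addEdge G x y x≢y)
    saturated x y x≢y ¬xy with perfectMatching? (addEdge G x y x≢y)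
    ... | yes pm = pm
    ... | no ¬pm = ⊥-elim (none (x , y , x≢y , ¬xy , ¬pm))
  ... | yes (x , y , x≢y , ¬xy , ¬pm′) with fuel
  ...   | zero = ⊥-elim (<-irrefl refl (≤-trans (≤-trans (nonEdges-addEdge G x y x≢y ¬xy) ≤fuel) z≤n))
  ...   | suc fuel = barrier-addEdge⁻ G x y x≢y
           (go fuel _ (≤-pred (≤-trans (nonEdges-addEdge G x y x≢y ¬xy) ≤fuel)) n-even ¬pm′)

-- Components

module _ {n} {G : SimpleGraph n} where

  _++ʷ_ : ∀ {u v w} → Walk G u v → Walk G v w → Walk G u w
  nil       ++ʷ q = q
  cons uw p ++ʷ q = cons uw (p ++ʷ q)

  reverseʷ : ∀ {u v} → Walk G u v → Walk G v u
  reverseʷ nil         = nil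
  reverseʷ (cons uw p) = reverseʷ p ++ʷ cons (Adj-sym G uw) nil

Closed : ∀ {n} → SimpleGraph n → Subset n → Set
Closed G X = ∀ u v → X u ≡ true → Adj G u v → X v ≡ true

nonempty : ∀ {n} → Subset n → Bool
nonempty X = ⌊ Fin.any? (λ u → X u Bool.≟ true) ⌋

nonempty-intro : ∀ {n} (X : Subset n) u → X u ≡ true → nonempty X ≡ true
nonempty-intro X u Xu with Fin.any? (λ u → X u Bool.≟ true)
... | yes _ = refl
... | no ∄  = ⊥-elim (∄ (u , Xu))

nonempty-elim : ∀ {n} (X : Subset n) → nonempty X ≡ true → ∃ λ u → X u ≡ true
nonempty-elim X _ with Fin.any? (λ u → X u Bool.≟ true)
... | yes ∃u = ∃u

nonempty-cong : ∀ {n} {X Y : Subset n} → (∀ u → X u ≡ Y u) → nonempty X ≡ nonempty Y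
nonempty-cong {X = X} {Y} X≗Y with Fin.any? (λ u → X u Bool.≟ true) | Fin.any? (λ u → Y u Bool.≟ true)
... | yes _        | yes _        = refl
... | no _         | no _         = refl
... | yes (u , Xu) | no ∄Y        = ⊥-elim (∄Y (u , trans (sym (X≗Y u)) Xu))
... | no ∄X        | yes (u , Yu) = ⊥-elim (∄X (u , trans (X≗Y u) Yu))

module Component {n} (G : SimpleGraph n) (v₀ : Fin n) where

  step : Subset n → Subset n
  step X v = X v ∨ nonempty (λ u → X u ∧ adj G u v)

  ball : ℕ → Subset n
  ball zero    = ⁅ v₀ ⁆
  ball (suc k) = step (ball k)

  ball-⊆ : ∀ k → ball k ⊆ ball (suc k)
  ball-⊆ k v ball-v rewrite ball-v = refl

  walk-to-ball : ∀ k v → ball k v ≡ true → Walk G v₀ v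
  walk-to-ball zero    v v₀-v with ==⇒≡ {i = v} v₀-v
  ... | refl = nil
  walk-to-ball (suc k) v ball-v with ∨-true (ball k v) ball-v
  ... | inj₁ old = walk-to-ball k v old
  ... | inj₂ new with nonempty-elim _ new
  ...   | u , ball-u∧uv with ∧-true (ball k u) ball-u∧uv
  ...     | ball-u , uv = walk-to-ball k u ball-u ++ʷ cons uv nil

  Stable : ℕ → Set
  Stable k = ∀ v → ball (suc k) v ≡ ball k v

  stable-suc : ∀ k → Stable k → Stable (suc k)
  stable-suc k stable v = cong₂ _∨_ (stable v) (nonempty-cong λ u → cong (_∧ adj G u v) (stable u))

  grow-or-stable : ∀ k → k + 1 ≤ ∣ ball k ∣ ⊎ Stable k
  grow-or-stable zero = inj₁ (≤-reflexive (sym (∣⁅⁆∣ v₀)))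
  grow-or-stable (suc k) with grow-or-stable k
  ... | inj₂ stable = inj₂ (stable-suc k stable)
  ... | inj₁ large with Fin.all? (λ v → ball (suc k) v Bool.≟ ball k v)
  ...   | yes stable = inj₂ (stable-suc k stable)
  ...   | no ¬stable with Fin.¬∀⟶∃¬ n _ (λ v → ball (suc k) v Bool.≟ ball k v) ¬stable
  ...     | v , new-v = inj₁ (≤-trans (s≤s large) (∣∣-mono-< (ball-⊆ k) v (proj₂ fresh) (proj₁ fresh)))
    where
    fresh : ball (suc k) v ≡ true × ball k v ≡ false
    fresh = lemma _ _ new-v (ball-⊆ k v)
      where
      lemma : ∀ a b → a ≢ b → (b ≡ true → a ≡ true) → a ≡ true × b ≡ false
      lemma true  false _   _   = refl , refl
      lemma true  true  a≢b _   = ⊥-elim (a≢b refl)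
      lemma false false a≢b _   = ⊥-elim (a≢b refl)
      lemma false true  _   b⇒a with b⇒a refl
      ... | ()

  component : Subset n
  component = ball n

  component-stable : Stable n
  component-stable with grow-or-stable n
  ... | inj₂ stable = stable
  ... | inj₁ large  = ⊥-elim (<-irrefl refl (≤-trans (subst (_≤ ∣ ball n ∣) (+-comm n 1) large) (∣∣≤n (ball n))))

  component-closed : Closed G component
  component-closed u v in-u uv =
    trans (sym (component-stable v))
          (trans (cong (component v ∨_) (nonempty-intro _ u (cong₂ _∧_ in-u uv))) (Bool.∨-zeroʳ _))

  v₀∈component : component v₀ ≡ true
  v₀∈component = in-ball n
    where
    in-ball : ∀ k → ball k v₀ ≡ true
    in-ball zero    = ==-refl v₀
    in-ball (suc k) = ball-⊆ k v₀ (in-ball k)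

  connected-if-component-full : (∀ v → component v ≡ true) → Connected G
  connected-if-component-full full u v = reverseʷ (walk-to-ball n u (full u)) ++ʷ walk-to-ball n v (full v)

-- Counting edges in regular graphs

handshake : ∀ {n} (f : Fin n → Fin n → ℕ) → (∀ i j → f i j ≡ f j i) → (∀ i → f i i ≡ 0) →
  odd (sum λ i → sum λ j → f i j) ≡ false
handshake {zero}  f f-sym f-diag = refl
handshake {suc n} f f-sym f-diag = begin
  odd (sum λ i → sum λ j → f i j)   ≡⟨ cong odd decompose ⟩
  odd (X + (X + I))                 ≡⟨ odd-+ X (X + I) ⟩
  odd X xor odd (X + I)             ≡⟨ cong (odd X xor_) (odd-+ X I) ⟩
  odd X xor (odd X xor odd I)       ≡⟨ Bool.xor-assoc (odd X) (odd X) (odd I) ⟨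
  (odd X xor odd X) xor odd I       ≡⟨ cong (_xor odd I) (Bool.xor-same (odd X)) ⟩
  odd I                             ≡⟨ handshake (λ i j → f (suc i) (suc j)) (λ i j → f-sym (suc i) (suc j)) (f-diag ∘ suc) ⟩
  false                             ∎
  where
  open ≡-Reasoning
  X = sum λ j → f zero (suc j)
  I = sum λ i → sum λ j → f (suc i) (suc j)
  decompose : (sum λ i → sum λ j → f i j) ≡ X + (X + I)
  decompose = cong₂ _+_ (cong (_+ X) (f-diag zero))
    (trans (∑-distrib-+ (λ i → f (suc i) zero) (λ i → sum λ j → f (suc i) (suc j)))
           (cong (_+ I) (sum-cong-≗ λ i → f-sym (suc i) zero)))

degree≡sum : ∀ {n} (G : SimpleGraph n) v → degree G v ≡ sum λ w → bit (adj G v w)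
degree≡sum G v = foldr≡sum (adj G v)
  where
  foldr≡sum : ∀ {m} (h : Fin m → Bool) → foldr (λ b acc → bit b + acc) 0 h ≡ sum (bit ∘ h)
  foldr≡sum {zero}  h = refl
  foldr≡sum {suc m} h = cong (bit (h zero) +_) (foldr≡sum (h ∘ suc))

module _ {n} {G : SimpleGraph n} {S X : Subset n} (P : OddParts G S X) where
  open OddParts P

  parts-cover : ∀ v → sum (λ w → bit (R w) * bit (C w v)) ≤ bit (X v)
  parts-cover v with X v in Xv
  ... | true = sum-≤1 _ (λ w → bit*bit≤1 (R w) (C w v)) unique
    where
    bit*bit≤1 : ∀ a b → bit a * bit b ≤ 1
    bit*bit≤1 true  true  = s≤s z≤n
    bit*bit≤1 true  false = z≤n
    bit*bit≤1 false _     = z≤n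
    in-part : ∀ w → 0 < bit (R w) * bit (C w v) → R w ≡ true × C w v ≡ true
    in-part w 0<RC with R w | C w v
    ... | true | true = refl , refl
    unique : ∀ w w′ → 0 < bit (R w) * bit (C w v) → 0 < bit (R w′) * bit (C w′ v) → w ≡ w′
    unique w w′ v∈w v∈w′ with w Fin.≟ w′
    ... | yes w≡w′ = w≡w′
    ... | no w≢w′ with in-part w v∈w | in-part w′ v∈w′
    ...   | Rw , Cwv | Rw′ , Cw′v with trans (sym Cw′v) (C-disjoint w w′ Rw Rw′ w≢w′ v Cwv)
    ...     | ()
  ... | false = ≤-reflexive (sum-zero outside)
    where
    outside : ∀ w → bit (R w) * bit (C w v) ≡ 0
    outside w with R w in Rw | C w v in Cwv
    ... | true  | true with trans (sym (C-⊆ w Rw v Cwv)) Xv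
    ...   | ()
    outside w | true  | false = refl
    outside w | false | _     = refl

  parts-sum : ∀ (g : Fin n → ℕ) →
    sum (λ w → bit (R w) * sum (λ v → bit (C w v) * g v)) ≤ sum (λ v → bit (X v) * g v)
  parts-sum g = begin
    sum (λ w → bit (R w) * sum (λ v → bit (C w v) * g v))   ≡⟨ sum-cong-≗ (λ w → *-distribˡ-sum (bit (R w)) (λ v → bit (C w v) * g v)) ⟩
    sum (λ w → sum (λ v → bit (R w) * (bit (C w v) * g v))) ≡⟨ ∑-comm (λ w v → bit (R w) * (bit (C w v) * g v)) ⟩
    sum (λ v → sum (λ w → bit (R w) * (bit (C w v) * g v))) ≡⟨ sum-cong-≗ (λ v → trans (sum-cong-≗ λ w → reassoc (bit (R w)) _ (g v))
                                                                                         (sym (*-distribˡ-sum (g v) (λ w → bit (R w) * bit (C w v))))) ⟩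
    sum (λ v → g v * sum (λ w → bit (R w) * bit (C w v)))   ≤⟨ sum-mono-≤ (λ v → *-monoʳ-≤ (g v) (parts-cover v)) ⟩
    sum (λ v → g v * bit (X v))                            ≡⟨ sum-cong-≗ (λ v → *-comm (g v) _) ⟩
    sum (λ v → bit (X v) * g v)                            ∎
    where
    open ≤-Reasoning
    reassoc : ∀ a b c → a * (b * c) ≡ c * (a * b)
    reassoc a b c = trans (sym (*-assoc a b c)) (*-comm (a * b) c)

module RegularCounting {n} (G : SimpleGraph n) {r} (regular : Regular r G) where

  degIn : Subset n → Fin n → ℕ
  degIn Y v = sum λ u → bit (Y u) * bit (adj G v u)

  edges : Subset n → Subset n → ℕ
  edges X Y = sum λ v → bit (X v) * degIn Y v

  sum-adj≡r : ∀ v → (sum λ u → bit (adj G v u)) ≡ r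
  sum-adj≡r v = trans (sym (degree≡sum G v)) (regular v)

  ∣closedNbhd∣ : ∀ v → ∣ closedNbhd G v ∣ ≡ suc r
  ∣closedNbhd∣ v = begin
    ∣ closedNbhd G v ∣                                       ≡⟨ sum-cong-≗ split ⟩
    sum (λ w → bit (v == w) + bit (adj G v w))                ≡⟨ ∑-distrib-+ (λ w → bit (v == w)) (λ w → bit (adj G v w)) ⟩
    sum (λ w → bit (v == w)) + sum (λ w → bit (adj G v w))   ≡⟨ cong₂ _+_ (trans (sum-single _ v λ w w≢v → cong bit (≢⇒==false (w≢v ∘ sym)))
                                                                              (cong bit (==-refl v)))
                                                                        (sum-adj≡r v) ⟩
    suc r                                                    ∎
    where
    open ≡-Reasoning
    split : ∀ w → bit (closedNbhd G v w) ≡ bit (v == w) + bit (adj G v w)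
    split w with v Fin.≟ w
    ... | yes refl rewrite loopless G v = refl
    ... | no _     = refl

  closed⇒large : ∀ {X} → Closed G X → ∀ {x₀} → X x₀ ≡ true → suc r ≤ ∣ X ∣
  closed⇒large {X} X-closed {x₀} Xx₀ = subst (_≤ ∣ X ∣) (∣closedNbhd∣ x₀) (∣∣-mono N⊆X)
    where
    N⊆X : closedNbhd G x₀ ⊆ X
    N⊆X v Nv with closedNbhd-cases G Nv
    ... | inj₁ refl = Xx₀
    ... | inj₂ x₀v  = X-closed x₀ v Xx₀ x₀v

  module _ {S H : Subset n} (H-avoids-S : ∀ v → H v ≡ true → S v ≡ false) (H-closed : ClosedOutside G S H) where

    degIn-split : ∀ v → H v ≡ true → degIn H v + degIn S v ≡ r
    degIn-split v Hv = trans (sym (∑-distrib-+ (λ u → bit (H u) * bit (adj G v u)) (λ u → bit (S u) * bit (adj G v u))))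
                             (trans (sum-cong-≗ split) (sum-adj≡r v))
      where
      split : ∀ u → bit (H u) * bit (adj G v u) + bit (S u) * bit (adj G v u) ≡ bit (adj G v u)
      split u with adj G v u in vu
      ... | false rewrite *-zeroʳ (bit (H u)) | *-zeroʳ (bit (S u)) = refl
      ... | true with S u in Su
      ...   | false rewrite H-closed v u Hv vu Su = refl
      ...   | true with H u in Hu
      ...     | false = refl
      ...     | true with trans (sym (H-avoids-S u Hu)) Su
      ...       | ()

    edges-split : edges H H + edges H S ≡ r * ∣ H ∣
    edges-split = trans (sym (∑-distrib-+ (λ v → bit (H v) * degIn H v) (λ v → bit (H v) * degIn S v)))
                        (trans (sum-cong-≗ split) (sym (*-distribˡ-sum r (λ v → bit (H v)))))
      where
      split : ∀ v → bit (H v) * degIn H v + bit (H v) * degIn S v ≡ r * bit (H v)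
      split v with H v in Hv
      ... | true rewrite +-identityʳ (degIn H v) | +-identityʳ (degIn S v) | *-identityʳ r = degIn-split v Hv
      ... | false = sym (*-zeroʳ r)

    edges-inside-even : odd (edges H H) ≡ false
    edges-inside-even = subst (λ k → odd k ≡ false)
      (sum-cong-≗ λ v → sym (*-distribˡ-sum (bit (H v)) (λ u → bit (H u) * bit (adj G v u))))
      (handshake (λ v u → bit (H v) * (bit (H u) * bit (adj G v u))) swap no-loops)
      where
      swap : ∀ v u → bit (H v) * (bit (H u) * bit (adj G v u)) ≡ bit (H u) * (bit (H v) * bit (adj G u v))
      swap v u rewrite symmetric G v u | sym (*-assoc (bit (H v)) (bit (H u)) (bit (adj G u v)))
                     | *-comm (bit (H v)) (bit (H u)) = *-assoc (bit (H u)) (bit (H v)) (bit (adj G u v))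
      no-loops : ∀ v → bit (H v) * (bit (H v) * bit (adj G v v)) ≡ 0
      no-loops v rewrite loopless G v | *-zeroʳ (bit (H v)) = *-zeroʳ (bit (H v))

    -- Each vertex of H sends r edges, the edges inside H are counted twice, so the rest is odd.
    edges-out-odd : odd r ≡ true → odd ∣ H ∣ ≡ true → odd (edges H S) ≡ true
    edges-out-odd r-odd H-odd = begin
      odd (edges H S)                               ≡⟨ cong (_xor odd (edges H S)) edges-inside-even ⟨
      odd (edges H H) xor odd (edges H S)           ≡⟨ odd-+ (edges H H) (edges H S) ⟨
      odd (edges H H + edges H S)                   ≡⟨ cong odd edges-split ⟩
      odd (r * ∣ H ∣)                               ≡⟨ odd-* r ∣ H ∣ ⟩
      odd r ∧ odd ∣ H ∣                             ≡⟨ cong₂ _∧_ r-odd H-odd ⟩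
      true                                          ∎
      where open ≡-Reasoning

    edges-out-pos : odd r ≡ true → odd ∣ H ∣ ≡ true → 1 ≤ edges H S
    edges-out-pos r-odd H-odd = odd⇒pos (edges H S) (edges-out-odd r-odd H-odd)

    degIn-self< : ∀ v → H v ≡ true → degIn H v < ∣ H ∣
    degIn-self< v Hv = ≤-trans (s≤s (sum-mono-≤ within)) (≤-reflexive (sym (∣∣-remove H Hv)))
      where
      within : ∀ u → bit (H u) * bit (adj G v u) ≤ bit ((H ∖ ⁅ v ⁆) u)
      within u with u Fin.≟ v
      ... | yes refl rewrite loopless G u | *-zeroʳ (bit (H u)) = z≤n
      ... | no u≢v rewrite ≢⇒==false u≢v | Bool.∧-identityʳ (H u) with adj G v u
      ...   | true  rewrite *-identityʳ (bit (H u)) = ≤-refl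
      ...   | false rewrite *-zeroʳ (bit (H u)) = z≤n

    -- A small H forces every vertex of H to have at least r + 1 − ∣ H ∣ neighbours in S.
    edges-out-small : odd ∣ H ∣ ≡ true → ∣ H ∣ ≤ r → r ≤ edges H S
    edges-out-small H-odd ∣H∣≤r = begin
      r                                      ≡⟨ m+[n∸m]≡n ∣H∣≤r ⟨
      ∣ H ∣ + (r ∸ ∣ H ∣)                    ≤⟨ arith ∣ H ∣ H-nonempty ⟩
      ∣ H ∣ * suc (r ∸ ∣ H ∣)                ≡⟨ *-comm ∣ H ∣ _ ⟩
      suc (r ∸ ∣ H ∣) * ∣ H ∣                ≡⟨ *-distribˡ-sum (suc (r ∸ ∣ H ∣)) (λ v → bit (H v)) ⟩
      sum (λ v → suc (r ∸ ∣ H ∣) * bit (H v)) ≤⟨ sum-mono-≤ out-bound ⟩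
      edges H S                              ∎
      where
      open ≤-Reasoning
      H-nonempty = odd⇒pos ∣ H ∣ H-odd
      arith : ∀ h → 1 ≤ h → ∀ {b} → h + b ≤ h * suc b
      arith (suc h) _ {b} = s≤s (subst (_≤ b + h * suc b) (+-comm b h) (+-monoʳ-≤ b (m≤m*n h (suc b))))
      out-bound : ∀ v → suc (r ∸ ∣ H ∣) * bit (H v) ≤ bit (H v) * degIn S v
      out-bound v with H v in Hv
      ... | false rewrite *-zeroʳ (r ∸ ∣ H ∣) = z≤n
      ... | true rewrite *-identityʳ (r ∸ ∣ H ∣) | +-identityʳ (degIn S v) =
        +-cancelˡ-≤ (degIn H v) _ _ (begin
          degIn H v + suc (r ∸ ∣ H ∣)   ≡⟨ +-suc (degIn H v) _ ⟩
          suc (degIn H v) + (r ∸ ∣ H ∣) ≤⟨ +-monoˡ-≤ (r ∸ ∣ H ∣) (degIn-self< v Hv) ⟩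
          ∣ H ∣ + (r ∸ ∣ H ∣)           ≡⟨ m+[n∸m]≡n ∣H∣≤r ⟩
          r                             ≡⟨ degIn-split v Hv ⟨
          degIn H v + degIn S v         ∎)

  edges-into : ∀ {X} → Closed G X → ∀ S → edges X S ≤ r * ∣ S ∩ X ∣
  edges-into {X} X-closed S = begin
    edges X S                                                   ≡⟨ sum-cong-≗ (λ v → *-distribˡ-sum (bit (X v)) (λ u → bit (S u) * bit (adj G v u))) ⟩
    sum (λ v → sum (λ u → bit (X v) * (bit (S u) * bit (adj G v u)))) ≡⟨ ∑-comm (λ v u → bit (X v) * (bit (S u) * bit (adj G v u))) ⟩
    sum (λ u → sum (λ v → bit (X v) * (bit (S u) * bit (adj G v u)))) ≤⟨ sum-mono-≤ per-vertex ⟩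
    sum (λ u → r * bit ((S ∩ X) u))                            ≡⟨ *-distribˡ-sum r (λ u → bit ((S ∩ X) u)) ⟨
    r * ∣ S ∩ X ∣                                               ∎
    where
    open ≤-Reasoning
    per-vertex : ∀ u → sum (λ v → bit (X v) * (bit (S u) * bit (adj G v u))) ≤ r * bit ((S ∩ X) u)
    per-vertex u with S u in Su | X u in Xu
    ... | false | _    = ≤-trans (≤-reflexive (sum-zero λ v → *-zeroʳ (bit (X v)))) z≤n
    ... | true  | true rewrite *-identityʳ r =
      ≤-trans (sum-mono-≤ at-most-adj) (≤-reflexive (sum-adj≡r u))
      where
      at-most-adj : ∀ v → bit (X v) * (1 * bit (adj G v u)) ≤ bit (adj G u v)
      at-most-adj v rewrite symmetric G v u | +-identityʳ (bit (adj G u v)) with X v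
      ... | true  = ≤-reflexive (+-identityʳ _)
      ... | false = z≤n
    ... | true  | false = ≤-trans (≤-reflexive (sum-zero no-neighbour)) z≤n
      where
      no-neighbour : ∀ v → bit (X v) * (1 * bit (adj G v u)) ≡ 0
      no-neighbour v with X v in Xv | adj G v u in vu
      ... | true  | true with trans (sym (X-closed v u Xv vu)) Xu
      ...   | ()
      no-neighbour v | true  | false = refl
      no-neighbour v | false | _     = refl

  module _ (r-odd : odd r ≡ true) {S X : Subset n} (X-closed : Closed G X) {x₀} (Xx₀ : X x₀ ≡ true)
           (P : OddParts G S X) where
    open OddParts P

    large : Subset n
    large w = ⌊ r <? ∣ C w ∣ ⌋

    edges-out-lower : ∀ w → r * bit ((R ∖ large) w) + bit ((R ∩ large) w) ≤ bit (R w) * edges (C w) S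
    edges-out-lower w with R w in Rw
    ... | false rewrite *-zeroʳ r = z≤n
    ... | true rewrite +-identityʳ (edges (C w) S) with r <? ∣ C w ∣
    ...   | yes _     rewrite *-zeroʳ r =
            edges-out-pos (C-avoids-S w Rw) (C-closed w Rw) r-odd (C-odd w Rw)
    ...   | no ¬large rewrite *-identityʳ r | +-identityʳ r =
            edges-out-small (C-avoids-S w Rw) (C-closed w Rw) (C-odd w Rw) (≮⇒≥ ¬large)

    -- Small parts send at least r edges into S, large ones at least one.
    small-large-edges : r * ∣ R ∖ large ∣ + ∣ R ∩ large ∣ ≤ r * ∣ S ∩ X ∣
    small-large-edges = begin
      r * ∣ R ∖ large ∣ + ∣ R ∩ large ∣
        ≡⟨ cong (_+ ∣ R ∩ large ∣) (*-distribˡ-sum r (λ w → bit ((R ∖ large) w))) ⟩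
      sum (λ w → r * bit ((R ∖ large) w)) + ∣ R ∩ large ∣
        ≡⟨ ∑-distrib-+ (λ w → r * bit ((R ∖ large) w)) (λ w → bit ((R ∩ large) w)) ⟨
      sum (λ w → r * bit ((R ∖ large) w) + bit ((R ∩ large) w))
        ≤⟨ sum-mono-≤ edges-out-lower ⟩
      sum (λ w → bit (R w) * edges (C w) S)
        ≤⟨ parts-sum P (degIn S) ⟩
      edges X S
        ≤⟨ edges-into X-closed S ⟩
      r * ∣ S ∩ X ∣ ∎
      where open ≤-Reasoning

    large-parts-size : ∣ R ∩ large ∣ * suc r ≤ ∣ X ∣
    large-parts-size = begin
      ∣ R ∩ large ∣ * suc r                                 ≡⟨ *-comm ∣ R ∩ large ∣ (suc r) ⟩
      suc r * ∣ R ∩ large ∣                                 ≡⟨ *-distribˡ-sum (suc r) (λ w → bit ((R ∩ large) w)) ⟩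
      sum (λ w → suc r * bit ((R ∩ large) w))               ≤⟨ sum-mono-≤ part-size ⟩
      sum (λ w → bit (R w) * sum (λ v → bit (C w v) * 1))   ≤⟨ parts-sum P (λ _ → 1) ⟩
      sum (λ v → bit (X v) * 1)                             ≡⟨ sum-cong-≗ (λ v → *-identityʳ (bit (X v))) ⟩
      ∣ X ∣                                                 ∎
      where
      open ≤-Reasoning
      part-size : ∀ w → suc r * bit ((R ∩ large) w) ≤ bit (R w) * sum (λ v → bit (C w v) * 1)
      part-size w with R w
      ... | false rewrite *-zeroʳ r = z≤n
      ... | true rewrite +-identityʳ (sum (λ v → bit (C w v) * 1)) with r <? ∣ C w ∣
      ...   | no _  rewrite *-zeroʳ r = z≤n
      ...   | yes r<∣C∣ rewrite *-identityʳ r =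
              ≤-trans r<∣C∣ (≤-reflexive (sum-cong-≗ λ v → sym (*-identityʳ (bit (C w v)))))

    odd-parts-bound : ∃ λ M → M * suc r ≤ ∣ X ∣ × ∣ R ∣ + 1 ≤ ∣ S ∩ X ∣ + M
    odd-parts-bound with ∣ R ∩ large ∣ in ∣L∣≡ | small-large-edges | large-parts-size
    ... | zero | edges-bound | _ =
      1 , subst (_≤ ∣ X ∣) (sym (+-identityʳ (suc r))) (closed⇒large X-closed Xx₀) ,
      subst (λ k → k + 1 ≤ ∣ S ∩ X ∣ + 1) (sym (trans (∣∣-split R large) (cong (_+ ∣ R ∖ large ∣) ∣L∣≡)))
        (+-monoˡ-≤ 1 (*-cancelˡ-≤ r {{odd⇒nonZero r-odd}} (subst (_≤ r * ∣ S ∩ X ∣) (+-identityʳ _) edges-bound)))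
    ... | suc L | edges-bound | size-bound =
      suc L , size-bound ,
      subst (λ k → k + 1 ≤ ∣ S ∩ X ∣ + suc L) (sym (trans (∣∣-split R large) (cong (_+ ∣ R ∖ large ∣) ∣L∣≡)))
        (begin
          suc L + ∣ R ∖ large ∣ + 1   ≡⟨ trans (+-assoc (suc L) _ 1) (trans (cong (suc L +_) (+-comm _ 1)) (+-comm (suc L) _)) ⟩
          suc ∣ R ∖ large ∣ + suc L   ≤⟨ +-monoˡ-≤ (suc L) fewer-small ⟩
          ∣ S ∩ X ∣ + suc L           ∎)
      where
      open ≤-Reasoning
      fewer-small : ∣ R ∖ large ∣ < ∣ S ∩ X ∣
      fewer-small = *-cancelˡ-< r _ _ (≤-trans (≤-trans (s≤s (m≤m+n (r * ∣ R ∖ large ∣) L)) (≤-reflexive (sym (+-suc _ L)))) edges-bound)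

module _ {n} {G : SimpleGraph n} {S : Subset n} (P : OddParts G S full) (A : Subset n) where
  open OddParts P

  oddIn : Subset n
  oddIn w = odd ∣ C w ∩ A ∣

  partsIn : Closed G A → OddParts G S A
  partsIn A-closed = record
    { R = R ∩ oddIn ; C = λ w → C w ∩ A
    ; C-⊆ = λ w _ v CAv → proj₂ (∧-true (C w v) CAv)
    ; C-avoids-S = λ w Rw v CAv → C-avoids-S w (proj₁ (∧-true (R w) Rw)) v (proj₁ (∧-true (C w v) CAv))
    ; C-disjoint = λ w w′ Rw Rw′ w≢w′ v CAv →
        cong (_∧ A v) (C-disjoint w w′ (proj₁ (∧-true (R w) Rw)) (proj₁ (∧-true (R w′) Rw′)) w≢w′ v (proj₁ (∧-true (C w v) CAv)))
    ; C-closed = λ w Rw u v CAu uv Sv → let Cu , Au = ∧-true (C w u) CAu in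
        cong₂ _∧_ (C-closed w (proj₁ (∧-true (R w) Rw)) u v Cu uv Sv) (A-closed u v Au uv)
    ; C-odd = λ w Rw → proj₂ (∧-true (R w) Rw)
    }

  partsOutside : Closed G (∁ A) → OddParts G S (∁ A)
  partsOutside ∁A-closed = record
    { R = R ∖ oddIn ; C = λ w → C w ∖ A
    ; C-⊆ = λ w _ v CAv → proj₂ (∧-true (C w v) CAv)
    ; C-avoids-S = λ w Rw v CAv → C-avoids-S w (proj₁ (∧-true (R w) Rw)) v (proj₁ (∧-true (C w v) CAv))
    ; C-disjoint = λ w w′ Rw Rw′ w≢w′ v CAv →
        cong (_∧ not (A v)) (C-disjoint w w′ (proj₁ (∧-true (R w) Rw)) (proj₁ (∧-true (R w′) Rw′)) w≢w′ v (proj₁ (∧-true (C w v) CAv)))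
    ; C-closed = λ w Rw u v CAu uv Sv → let Cu , ∁Au = ∧-true (C w u) CAu in
        cong₂ _∧_ (C-closed w (proj₁ (∧-true (R w) Rw)) u v Cu uv Sv) (∁A-closed u v ∁Au uv)
    ; C-odd = λ w Rw → let Rw , even-in-A = ∧-true (R w) Rw in begin
        odd ∣ C w ∖ A ∣                             ≡⟨ cong (_xor odd ∣ C w ∖ A ∣) (Bool.not-injective even-in-A) ⟨
        odd ∣ C w ∩ A ∣ xor odd ∣ C w ∖ A ∣         ≡⟨ odd-+ ∣ C w ∩ A ∣ ∣ C w ∖ A ∣ ⟨
        odd (∣ C w ∩ A ∣ + ∣ C w ∖ A ∣)             ≡⟨ cong odd (∣∣-split (C w) A) ⟨
        odd ∣ C w ∣                                 ≡⟨ C-odd w Rw ⟩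
        true                                        ∎
    }
    where open ≡-Reasoning

at-least-four : ∀ {qA qB sA sB MA MB} → qA + 1 ≤ sA + MA → qB + 1 ≤ sB + MB → (sA + sB) + 2 ≤ qA + qB →
  4 ≤ MA + MB
at-least-four {qA} {qB} {sA} {sB} {MA} {MB} boundA boundB deficient = +-cancelˡ-≤ (sA + sB) 4 (MA + MB) (begin
  (sA + sB) + 4               ≡⟨ +-assoc (sA + sB) 2 2 ⟨
  ((sA + sB) + 2) + 2         ≤⟨ +-monoˡ-≤ 2 deficient ⟩
  (qA + qB) + 2               ≡⟨ split-2 qA qB ⟩
  (qA + 1) + (qB + 1)         ≤⟨ +-mono-≤ boundA boundB ⟩
  (sA + MA) + (sB + MB)       ≡⟨ interchange sA MA sB MB ⟩
  (sA + sB) + (MA + MB)       ∎)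
  where
  open ≤-Reasoning
  split-2 : ∀ x y → (x + y) + 2 ≡ (x + 1) + (y + 1)
  split-2 = solve-∀
  interchange : ∀ a b c d → (a + b) + (c + d) ≡ (a + c) + (b + d)
  interchange = solve-∀

-- Counting the odd parts on both sides of the disconnection yields four disjoint blocks of r + 1 vertices.
no-barrier-if-disconnected : ∀ {n} (G : SimpleGraph n) {r} → Regular r G → odd r ≡ true → n ≤ 4 * r →
  ∀ {A} → Closed G A → ∀ {a b} → A a ≡ true → A b ≡ false → ¬ Barrier G
no-barrier-if-disconnected {n} G {r} regular r-odd n≤4r {A} A-closed Aa Ab B =
  <-irrefl refl (begin-strict
    4 * r                   <⟨ *-monoʳ-< 4 (n<1+n r) ⟩
    4 * suc r               ≤⟨ *-monoˡ-≤ (suc r) (at-least-four {MA = MA} {MB = MB} boundA boundB deficient′) ⟩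
    (MA + MB) * suc r       ≡⟨ *-distribʳ-+ (suc r) MA MB ⟩
    MA * suc r + MB * suc r ≤⟨ +-mono-≤ sizeA sizeB ⟩
    ∣ A ∣ + ∣ ∁ A ∣          ≡⟨ trans (sym (∣∣-split full A)) ∣full∣ ⟩
    n                       ≤⟨ n≤4r ⟩
    4 * r                   ∎)
  where
  open ≤-Reasoning
  open RegularCounting G regular
  open Barrier B
  open OddParts parts using (R)
  ∁A-closed : Closed G (∁ A)
  ∁A-closed u v ∁Au uv =
    cong not (Bool.¬-not {y = true} λ Av → Bool.not-¬ (A-closed v u Av (Adj-sym G uv)) (Bool.not-injective ∁Au))
  sideA = odd-parts-bound r-odd A-closed Aa (partsIn parts A A-closed)
  sideB = odd-parts-bound r-odd ∁A-closed (cong not Ab) (partsOutside parts A ∁A-closed)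
  MA = proj₁ sideA
  MB = proj₁ sideB
  sizeA = proj₁ (proj₂ sideA)
  sizeB = proj₁ (proj₂ sideB)
  boundA = proj₂ (proj₂ sideA)
  boundB = proj₂ (proj₂ sideB)
  deficient′ : (∣ S ∩ A ∣ + ∣ S ∖ A ∣) + 2 ≤ ∣ R ∩ oddIn parts A ∣ + ∣ R ∖ oddIn parts A ∣
  deficient′ = subst₂ (λ s q → s + 2 ≤ q) (∣∣-split S A) (∣∣-split R (oddIn parts A)) deficient

disconnected⇒split : ∀ {n} (G : SimpleGraph n) → ¬ Connected G →
  Σ (Subset n) λ A → Closed G A × (∃ λ a → A a ≡ true) × (∃ λ b → A b ≡ false)
disconnected⇒split {zero}  G disconnected = ⊥-elim (disconnected λ ())
disconnected⇒split {suc n} G disconnected with Fin.all? (λ v → Component.component G zero v Bool.≟ true)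
... | yes all-in = ⊥-elim (disconnected (Component.connected-if-component-full G zero all-in))
... | no ¬full with Fin.¬∀⟶∃¬ _ _ (λ v → Component.component G zero v Bool.≟ true) ¬full
...   | b , b∉A = Component.component G zero , Component.component-closed G zero ,
                  (zero , Component.v₀∈component G zero) , (b , Bool.¬-not b∉A)

mainTheorem3 : (n r : ℕ) (G : SimpleGraph n) →
    2 ∣ n → ¬ (2 ∣ r) → 15 < r → n ≤ 4 * r →
    Regular r G → ¬ Connected G → PerfectMatching G
mainTheorem3 n r G 2∣n ¬2∣r _ n≤4r regular disconnected with perfectMatching? G
... | yes pm = pm
... | no ¬pm with disconnected⇒split G disconnected
...   | A , A-closed , (_ , Aa) , (_ , Ab) =
  ⊥-elim (no-barrier-if-disconnected G regular (¬2∣⇒odd r ¬2∣r) n≤4r A-closed Aa Ab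
            (tutte G (2∣⇒¬odd 2∣n) ¬pm))
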